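{- For all integers $n \geq 1$ and $k \geq 1$, \[ B_{n,k} = \operatorname{Vol}(\Delta_{C_n,2k-1}) + 2\operatorname{Vol}(\Delta_{C_n,2k}) + \operatorname{Vol}(\Delta_{C_n,2k+1}), \] where $\operatorname{Vol}(\Delta_{C_n,j}) := 0$ whenever $j < 1$ or $j > 2n-1$.
   Context: $\mathfrak{B}_n$ is the group of signed permutations (bijections $w$ of $\{ -n,\dots,-1,1,\dots,n\}$ with $w(-i)=-w(i)$), $w_i := w(i)$. $\operatorname{des}_B(w)$ is the number of $i \in \{0,\dots,n-1\}$ with $w_i > w_{i+1}$, where $w_0 := 0$. The type B Eulerian numbers are $B_{n,k} := |\{ w \in \mathfrak{B}_n \mid \operatorname{des}_B(w) = k\}|$. $\Pi_{C_n} := \{x \in \mathbb{R}^n \mid 0 \le 2x_1 \le 1,\ 0 \le x_i - x_{i-1} \le 1 \ (2 \le i \le n)\}$ and, for $1 \le j \le 2n-1$, $\Delta_{C_n,j} := \{x \in \Pi_{C_n} \mid j-1 \le 2x_n \le j\}$. $\operatorname{Vol}$ denotes normalized volume with respect to the lattice $\tfrac12\mathbb{Z}^n$, i.e. $n!\,2^n$ times the Euclidean volume. -}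

module Defs where

open import Data.Bool using (Bool; true; false; _∧_; not; if_then_else_)
open import Data.Nat as ℕ using (ℕ; zero; suc; _+_; _*_; _∸_; _^_; _≤ᵇ_; _≡ᵇ_)
open import Data.Nat.Properties using (m^n≢0)
open import Data.Nat using (_!)
open import Data.Integer as ℤ using (ℤ; +_; -[1+_])
open import Data.List using (List; []; _∷_; _++_; map; concatMap; upTo; filter; length; foldr)
open import Data.Bool.ListAction using (any)
open import Data.Rational as ℚ using (ℚ; _/_; _<_; 0ℚ)
open import Data.Product using (Σ; _×_; ∃)
open import Relation.Binary.PropositionalEquality using (_≡_)
open import Relation.Nullary.Decidable using (Dec; yes; no)

words : {A : Set} → List A → ℕ → List (List A)
words vals zero    = [] ∷ []
words vals (suc n) = concatMap (λ w → map (λ a → a ∷ w) vals) (words vals n)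

isTrue : (b : Bool) → Dec (b ≡ true)
isTrue true  = yes _≡_.refl
isTrue false = no (λ ())

count : {A : Set} → (A → Bool) → List A → ℕ
count p xs = length (filter (λ x → isTrue (p x)) xs)

-- A signed permutation w ∈ 𝔅_n is determined by its window
-- (w_1, …, w_n) ∈ ℤ^n; a list is such a window iff every entry lies in
-- {-n,…,-1,1,…,n} and the absolute values |w_1|,…,|w_n| are distinct.
signedValues : ℕ → List ℤ
signedValues n = map (λ i → + suc i) (upTo n) ++ map (λ i → -[1+ i ]) (upTo n)

distinctAbs : List ℤ → Bool
distinctAbs []       = true
distinctAbs (x ∷ xs) = not (any (λ y → ℤ.∣ x ∣ ≡ᵇ ℤ.∣ y ∣) xs) ∧ distinctAbs xs

signedPerms : ℕ → List (List ℤ)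
signedPerms n = filter (λ w → isTrue (distinctAbs w)) (words (signedValues n) n)

descents : List ℤ → ℕ
descents (a ∷ b ∷ rest) = (if b ℤ.≤ᵇ a then (if a ℤ.≤ᵇ b then 0 else 1) else 0) + descents (b ∷ rest)
descents _              = 0

desB : List ℤ → ℕ
desB w = descents (+ 0 ∷ w)

B : ℕ → ℕ → ℕ
B n k = count (λ w → desB w ≡ᵇ k) (signedPerms n)

-- For a grid parameter m ≥ 1 we use the grid (1/(2m))ℤ^n and write a grid
-- point as x = y/(2m) with y ∈ ℤ^n.  The inequalities of Δ_{C_n,j} become
--   0 ≤ y_1 ≤ m,   0 ≤ y_i - y_{i-1} ≤ 2m  (2 ≤ i ≤ n),
--   (j-1)·m ≤ y_n ≤ j·m .
-- (They force y_i ≥ 0, so it suffices to range over y ∈ ℕ^n, and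
--  y_i ≤ 2nm for j ≤ 2n, giving a finite box to enumerate.)

firstOK : ℕ → List ℕ → Bool
firstOK m []      = false
firstOK m (y ∷ _) = y ≤ᵇ m

chainOK : ℕ → List ℕ → Bool
chainOK m (a ∷ b ∷ rest) = (a ≤ᵇ b) ∧ ((b ≤ᵇ a + 2 * m) ∧ chainOK m (b ∷ rest))
chainOK m _              = true

lastOK : ℕ → ℕ → List ℕ → Bool
lastOK m j []       = false
lastOK m j (y ∷ []) = ((j ∸ 1) * m ≤ᵇ y) ∧ (y ≤ᵇ j * m)
lastOK m j (_ ∷ ys) = lastOK m j ys

inΔ : ℕ → ℕ → List ℕ → Bool
inΔ m j y = firstOK m y ∧ (chainOK m y ∧ lastOK m j y)

gridCount : (n j m : ℕ) → ℕ
gridCount n j m = count (inΔ m j) (words (upTo (suc (2 * n * m))) n)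

-- n! · #(Δ ∩ (1/(2m))ℤ^n) / m^n  =  n! 2^n · (Euclidean grid approximation
-- #(Δ ∩ (1/(2m))ℤ^n)·(2m)^{-n}) ;  here m = suc m'.
approxVol : (n j m' : ℕ) → ℚ
approxVol n j m' =
  (+ ((n !) * gridCount n j (suc m')) / (suc m' ^ n)) {{m^n≢0 (suc m') n}}

-- Normalized volume (w.r.t. ½ℤ^n) of Δ_{C_n,j} equals V: the Jordan-content
-- grid approximations converge to V.
HasNormVol : (n j : ℕ) → ℚ → Set
HasNormVol n j V =
  ∀ (ε : ℚ) → 0ℚ < ε →
    ∃ λ (M : ℕ) → ∀ (m' : ℕ) → M ℕ.≤ m' → ℚ.∣ approxVol n j m' ℚ.- V ∣ < ε

VolΔ : (n j : ℕ) → ℚ → Set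
VolΔ n j V = if (1 ≤ᵇ j) ∧ (j ≤ᵇ 2 * n ∸ 1) then HasNormVol n j V else V ≡ 0ℚ

-- Put y = 2m·x. A point of Δ_{C_n,j} on the grid (1/2m)ℤⁿ is a chain y₁ ≤ y₂ ≤ ⋯ ≤ yₙ with steps in [0, 2m], and up to
-- O(m^{n−1}) points the steps may be taken in [0, 2m). Writing yᵢ = 2m·cᵢ + rᵢ and reading the residues rᵢ ∈ [0, 2m) as
-- letters of ±[m] in increasing order, such a chain becomes a word whose descents are exactly the carries cᵢ₊₁ = cᵢ + 1.
-- Words with distinct absolute values are counted by C(m, n) times a sum over 𝔅ₙ, the other words are O(m^{n−1}); hence
-- Vol(Δ_{C_n,q+1}) is the integer #{w ∈ 𝔅ₙ | w₁ < 0, 2·des(w₁…wₙ) + [wₙ > 0] = q}. Counting the chains that start in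
-- [m, 3m) – the start then acts as w₀ = 0 – gives C(m, n)·B_{n,k} as well as C(m, n)·(Vol Δ_{2k−1} + 2 Vol Δ_{2k} +
-- Vol Δ_{2k+1}), both with an error which is smaller than C(m, n) for a suitable m, so the two integers coincide.

module Submission where

open import Defs
open import Data.Nat using (ℕ; _≤_; _+_; _*_; _∸_)
open import Data.Rational as ℚ using (ℚ)
open import Data.Integer using (+_)
open import Data.Product using (Σ; _×_; ∃)
open import Relation.Binary.PropositionalEquality using (_≡_)

open import Data.Bool using (Bool; true; false; _∧_; _∨_; not; T; if_then_else_)
open import Data.Bool.ListAction using (any)
open import Data.Bool.Properties using (∧-zeroʳ; ∨-zeroʳ)
open import Data.Empty using (⊥; ⊥-elim)
open import Data.Integer as ℤ using (ℤ; -[1+_]; +[1+_]; _⊖_)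
import Data.Integer.Properties as ℤ
open import Data.Integer.Tactic.RingSolver as ℤ-Solver using ()
open import Data.List using (List; []; _∷_; _++_; map; concatMap; upTo; applyUpTo; filter; length)
open import Data.List.Properties using (map-++; map-∘; map-applyUpTo; length-map; length-++; length-upTo)
open import Data.List.Relation.Unary.All as All using (All; []; _∷_)
open import Data.List.Relation.Unary.All.Properties using (map⁺; ++⁺; concat⁺; applyUpTo⁺₁)
open import Data.Nat hiding (_≤_; _+_; _*_; _∸_)
open import Data.Nat.ListAction using (sum)
open import Data.Nat.ListAction.Properties using (sum-++)
open import Data.Nat.Properties
open import Algebra.Properties.CommutativeSemigroup +-commutativeSemigroup using (interchange)
open import Data.Nat.Tactic.RingSolver using (solve-∀)
open import Data.Product using (_,_)
open import Data.Rational using (mkℚ; 0ℚ; toℚᵘ)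
import Data.Rational.Properties as ℚP
import Data.Rational.Unnormalised as ℚᵘ
import Data.Rational.Unnormalised.Properties as ℚᵘP
open import Data.Sum using (inj₁; inj₂)
open import Function using (_∘_)
open import Relation.Binary.Definitions using (tri<; tri≈; tri>)
open import Relation.Binary.PropositionalEquality using (refl; sym; trans; cong; cong₂; subst; subst₂; _≢_; module ≡-Reasoning)
open import Relation.Nullary using (Dec; yes; no)

-- Indicators and sums

𝟙 : Bool → ℕ
𝟙 true  = 1
𝟙 false = 0

𝟙≤1 : ∀ b → 𝟙 b ≤ 1
𝟙≤1 true  = ≤-refl
𝟙≤1 false = z≤n

𝟙-∧ : ∀ a b → 𝟙 (a ∧ b) ≡ 𝟙 a * 𝟙 b
𝟙-∧ true  b = sym (+-identityʳ (𝟙 b))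
𝟙-∧ false b = refl

𝟙-∨ : ∀ a b → 𝟙 (a ∨ b) ≤ 𝟙 a + 𝟙 b
𝟙-∨ true  b = s≤s z≤n
𝟙-∨ false b = ≤-refl

𝟙-∧-false : ∀ b → 𝟙 (b ∧ false) ≡ 0
𝟙-∧-false b = cong 𝟙 (∧-zeroʳ b)

𝟙-+-𝟙-not : ∀ b x → 𝟙 b * x + 𝟙 (not b) * x ≡ x
𝟙-+-𝟙-not true  x = trans (+-identityʳ (1 * x)) (*-identityˡ x)
𝟙-+-𝟙-not false x = *-identityˡ x

private variable A A′ : Set

∑ : (A → ℕ) → List A → ℕ
∑ f xs = sum (map f xs)

∑< : ℕ → (ℕ → ℕ) → ℕ
∑< n f = sum (applyUpTo f n)

∑-const : ∀ c (xs : List A) → ∑ (λ _ → c) xs ≡ c * length xs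
∑-const c []       = sym (*-zeroʳ c)
∑-const c (x ∷ xs) = trans (cong (_+_ c) (∑-const c xs)) (sym (*-suc c (length xs)))

∑-cong : ∀ {f g : A → ℕ} xs → (∀ x → f x ≡ g x) → ∑ f xs ≡ ∑ g xs
∑-cong []       e = refl
∑-cong (x ∷ xs) e = cong₂ _+_ (e x) (∑-cong xs e)

∑-congᴬ : ∀ {P : A → Set} {f g : A → ℕ} {xs} → All P xs → (∀ x → P x → f x ≡ g x) → ∑ f xs ≡ ∑ g xs
∑-congᴬ []         e = refl
∑-congᴬ (px ∷ pxs) e = cong₂ _+_ (e _ px) (∑-congᴬ pxs e)

∑-mono : ∀ {f g : A → ℕ} xs → (∀ x → f x ≤ g x) → ∑ f xs ≤ ∑ g xs
∑-mono []       e = z≤n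
∑-mono (x ∷ xs) e = +-mono-≤ (e x) (∑-mono xs e)

∑-++ : ∀ (f : A → ℕ) xs ys → ∑ f (xs ++ ys) ≡ ∑ f xs + ∑ f ys
∑-++ f xs ys = trans (cong sum (map-++ f xs ys)) (sum-++ (map f xs) (map f ys))

∑-+ : ∀ (f g : A → ℕ) xs → ∑ (λ x → f x + g x) xs ≡ ∑ f xs + ∑ g xs
∑-+ f g []       = refl
∑-+ f g (x ∷ xs) = trans (cong (_+_ (f x + g x)) (∑-+ f g xs)) (interchange (f x) (g x) (∑ f xs) (∑ g xs))

∑-*ˡ : ∀ c (f : A → ℕ) xs → ∑ (λ x → c * f x) xs ≡ c * ∑ f xs
∑-*ˡ c f []       = sym (*-zeroʳ c)
∑-*ˡ c f (x ∷ xs) = trans (cong (_+_ (c * f x)) (∑-*ˡ c f xs)) (sym (*-distribˡ-+ c (f x) (∑ f xs)))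

∑-swap : ∀ (h : A → A′ → ℕ) xs ys →
         ∑ (λ x → ∑ (h x) ys) xs ≡ ∑ (λ y → ∑ (λ x → h x y) xs) ys
∑-swap h []       ys = sym (∑-const 0 ys)
∑-swap h (x ∷ xs) ys = trans (cong (_+_ (∑ (h x) ys)) (∑-swap h xs ys))
                             (sym (∑-+ (h x) (λ y → ∑ (λ x′ → h x′ y) xs) ys))

∑-map : ∀ (f : A′ → ℕ) (g : A → A′) xs → ∑ f (map g xs) ≡ ∑ (f ∘ g) xs
∑-map f g xs = cong sum (sym (map-∘ xs))

∑-concatMap : ∀ (f : A′ → ℕ) (g : A → List A′) xs →
              ∑ f (concatMap g xs) ≡ ∑ (λ x → ∑ f (g x)) xs
∑-concatMap f g []       = refl
∑-concatMap f g (x ∷ xs) = trans (∑-++ f (g x) (concatMap g xs)) (cong (_+_ (∑ f (g x))) (∑-concatMap f g xs))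

∑-words-suc : ∀ (f : List A → ℕ) V n → ∑ f (words V (suc n)) ≡ ∑ (λ w → ∑ (λ a → f (a ∷ w)) V) (words V n)
∑-words-suc f V n = trans (∑-concatMap f (λ w → map (_∷ w) V) (words V n))
                          (∑-cong (words V n) (λ w → ∑-map f (_∷ w) V))

∑-filter : ∀ (g : A → ℕ) (d : A → Bool) xs → ∑ g (filter (isTrue ∘ d) xs) ≡ ∑ (λ x → 𝟙 (d x) * g x) xs
∑-filter g d []       = refl
∑-filter g d (x ∷ xs) with d x
... | true  = cong₂ _+_ (sym (+-identityʳ (g x))) (∑-filter g d xs)
... | false = ∑-filter g d xs

count-∑ : ∀ (p : A → Bool) xs → count p xs ≡ ∑ (𝟙 ∘ p) xs
count-∑ p []       = refl
count-∑ p (x ∷ xs) with p x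
... | true  = cong suc (count-∑ p xs)
... | false = count-∑ p xs

∑<-cong : ∀ n {f g : ℕ → ℕ} → (∀ i → i < n → f i ≡ g i) → ∑< n f ≡ ∑< n g
∑<-cong zero    e = refl
∑<-cong (suc n) e = cong₂ _+_ (e 0 z<s) (∑<-cong n (λ i i<n → e (suc i) (s<s i<n)))

∑<-mono : ∀ n {f g : ℕ → ℕ} → (∀ i → i < n → f i ≤ g i) → ∑< n f ≤ ∑< n g
∑<-mono zero    e = z≤n
∑<-mono (suc n) e = +-mono-≤ (e 0 z<s) (∑<-mono n (λ i i<n → e (suc i) (s<s i<n)))

∑<-+ : ∀ n (f g : ℕ → ℕ) → ∑< n (λ i → f i + g i) ≡ ∑< n f + ∑< n g
∑<-+ zero    f g = refl
∑<-+ (suc n) f g = trans (cong (_+_ (f 0 + g 0)) (∑<-+ n (f ∘ suc) (g ∘ suc)))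
                         (interchange (f 0) (g 0) (∑< n (f ∘ suc)) (∑< n (g ∘ suc)))

∑<-zero : ∀ n → ∑< n (λ _ → 0) ≡ 0
∑<-zero zero    = refl
∑<-zero (suc n) = ∑<-zero n

∑<-+-length : ∀ a b (f : ℕ → ℕ) → ∑< (a + b) f ≡ ∑< a f + ∑< b (λ i → f (a + i))
∑<-+-length zero    b f = refl
∑<-+-length (suc a) b f = trans (cong (_+_ (f 0)) (∑<-+-length a b (f ∘ suc))) (sym (+-assoc (f 0) _ _))

∑<-suc-last : ∀ n (f : ℕ → ℕ) → ∑< (suc n) f ≡ ∑< n f + f n
∑<-suc-last zero    f = +-identityʳ (f 0)
∑<-suc-last (suc n) f = trans (cong (_+_ (f 0)) (∑<-suc-last n (f ∘ suc))) (sym (+-assoc (f 0) _ _))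

∑<-reverse : ∀ n (f : ℕ → ℕ) → ∑< n (λ i → f (n ∸ suc i)) ≡ ∑< n f
∑<-reverse zero    f = refl
∑<-reverse (suc n) f = trans (cong (_+_ (f n)) (∑<-reverse n f))
                             (trans (+-comm (f n) (∑< n f)) (sym (∑<-suc-last n f)))

∑<-window : ∀ n k d (f : ℕ → ℕ) → d + k ≤ n → ∑< k (λ i → f (d + i)) ≤ ∑< n f
∑<-window n k d f d+k≤n with m≤n⇒∃[o]m+o≡n d+k≤n
... | o , refl = begin
  ∑< k (λ i → f (d + i))                   ≤⟨ m≤n+m _ (∑< d f) ⟩
  ∑< d f + ∑< k (λ i → f (d + i))          ≡⟨ ∑<-+-length d k f ⟨
  ∑< (d + k) f                             ≤⟨ m≤m+n _ _ ⟩
  ∑< (d + k) f + ∑< o (λ i → f (d + k + i)) ≡⟨ ∑<-+-length (d + k) o f ⟨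
  ∑< (d + k + o) f                         ∎
  where open ≤-Reasoning

∑<-vanishing-tail : ∀ n k (f : ℕ → ℕ) → (∀ i → n ≤ i → f i ≡ 0) → ∑< (n + k) f ≡ ∑< n f
∑<-vanishing-tail n k f f≡0 = begin
  ∑< (n + k) f                        ≡⟨ ∑<-+-length n k f ⟩
  ∑< n f + ∑< k (λ i → f (n + i))     ≡⟨ cong (_+_ (∑< n f)) (∑<-cong k (λ i _ → f≡0 (n + i) (m≤m+n n i))) ⟩
  ∑< n f + ∑< k (λ _ → 0)             ≡⟨ cong (_+_ (∑< n f)) (∑<-zero k) ⟩
  ∑< n f + 0                          ≡⟨ +-identityʳ _ ⟩
  ∑< n f                              ∎
  where open ≡-Reasoning

∑-upTo : ∀ (f : ℕ → ℕ) n → ∑ f (upTo n) ≡ ∑< n f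
∑-upTo f n = cong sum (map-applyUpTo (λ i → i) f n)

T⇒≡true : ∀ {b} → T b → b ≡ true
T⇒≡true {true} _ = refl

¬T⇒≡false : ∀ {b} → (T b → ⊥) → b ≡ false
¬T⇒≡false {true}  ¬t = ⊥-elim (¬t _)
¬T⇒≡false {false} _  = refl

≤ᵇ-true : ∀ {m n} → m ≤ n → (m ≤ᵇ n) ≡ true
≤ᵇ-true m≤n = T⇒≡true (≤⇒≤ᵇ m≤n)

≤ᵇ-false : ∀ {m n} → n < m → (m ≤ᵇ n) ≡ false
≤ᵇ-false {m} {n} n<m = ¬T⇒≡false (λ t → <⇒≱ n<m (≤ᵇ⇒≤ m n t))

<ᵇ-true : ∀ {m n} → m < n → (m <ᵇ n) ≡ true
<ᵇ-true m<n = T⇒≡true (<⇒<ᵇ m<n)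

<ᵇ-false : ∀ {m n} → n ≤ m → (m <ᵇ n) ≡ false
<ᵇ-false {m} {n} n≤m = ¬T⇒≡false (λ t → <⇒≱ (<ᵇ⇒< m n t) n≤m)

≡ᵇ-refl : ∀ m → (m ≡ᵇ m) ≡ true
≡ᵇ-refl m = T⇒≡true (≡⇒≡ᵇ m m refl)

≡ᵇ-false : ∀ {m n} → m ≢ n → (m ≡ᵇ n) ≡ false
≡ᵇ-false {m} {n} m≢n = ¬T⇒≡false (λ t → m≢n (≡ᵇ⇒≡ m n t))

≤ᵇ-≡ : ∀ {x y x′ y′} → (x ≤ y → x′ ≤ y′) → (x′ ≤ y′ → x ≤ y) → (x ≤ᵇ y) ≡ (x′ ≤ᵇ y′)
≤ᵇ-≡ {x} {y} {x′} {y′} to from with x ≤? y | x′ ≤? y′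
... | yes p | yes q = trans (≤ᵇ-true p) (sym (≤ᵇ-true q))
... | yes p | no ¬q = ⊥-elim (¬q (to p))
... | no ¬p | yes q = ⊥-elim (¬p (from q))
... | no ¬p | no ¬q = trans (≤ᵇ-false (≰⇒> ¬p)) (sym (≤ᵇ-false (≰⇒> ¬q)))

-- Words over ±[m] = {-m,…,-1,1,…,m}

signedWords : ℕ → ℕ → List (List ℤ)
signedWords m = words (signedValues m)

Bounded : ℕ → ℤ → Set
Bounded m a = ℤ.∣ a ∣ ≤ m

∑-signedValues : ∀ m (h : ℤ → ℕ) → ∑ h (signedValues m) ≡ ∑< m (h ∘ +[1+_]) + ∑< m (h ∘ -[1+_])
∑-signedValues m h = trans (∑-++ h (map +[1+_] (upTo m)) (map -[1+_] (upTo m)))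
  (cong₂ _+_ (trans (∑-map h +[1+_] (upTo m)) (∑-upTo _ m)) (trans (∑-map h -[1+_] (upTo m)) (∑-upTo _ m)))

∑-signedValues-suc : ∀ m (h : ℤ → ℕ) → ∑ h (signedValues (suc m)) ≡ ∑ h (signedValues m) + (h +[1+ m ] + h -[1+ m ])
∑-signedValues-suc m h = begin
  ∑ h (signedValues (suc m))                        ≡⟨ ∑-signedValues (suc m) h ⟩
  ∑< (suc m) (h ∘ +[1+_]) + ∑< (suc m) (h ∘ -[1+_]) ≡⟨ cong₂ _+_ (∑<-suc-last m (h ∘ +[1+_])) (∑<-suc-last m (h ∘ -[1+_])) ⟩
  (P + h +[1+ m ]) + (N + h -[1+ m ])               ≡⟨ interchange P (h +[1+ m ]) N (h -[1+ m ]) ⟩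
  (P + N) + (h +[1+ m ] + h -[1+ m ])               ≡⟨ cong (_+ (h +[1+ m ] + h -[1+ m ])) (∑-signedValues m h) ⟨
  ∑ h (signedValues m) + (h +[1+ m ] + h -[1+ m ])  ∎
  where
  open ≡-Reasoning
  P N : ℕ
  P = ∑< m (h ∘ +[1+_])
  N = ∑< m (h ∘ -[1+_])

length-signedValues : ∀ m → length (signedValues m) ≡ 2 * m
length-signedValues m = begin
  length (signedValues m)                           ≡⟨ length-++ (map +[1+_] (upTo m)) ⟩
  length (map +[1+_] (upTo m)) + length (map -[1+_] (upTo m))
                                                    ≡⟨ cong₂ _+_ (trans (length-map _ (upTo m)) (length-upTo m))
                                                                 (trans (length-map _ (upTo m)) (length-upTo m)) ⟩
  m + m                                             ≡⟨ cong (_+_ m) (+-identityʳ m) ⟨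
  2 * m                                             ∎
  where open ≡-Reasoning

signedValues-bounded : ∀ m → All (Bounded m) (signedValues m)
signedValues-bounded m = ++⁺ (map⁺ (applyUpTo⁺₁ _ m (λ i<m → i<m))) (map⁺ (applyUpTo⁺₁ _ m (λ i<m → i<m)))

words-All : ∀ {A : Set} {P : A → Set} {V} → All P V → ∀ n → All (All P) (words V n)
words-All pV zero    = [] ∷ []
words-All pV (suc n) = concat⁺ (map⁺ (All.map (λ pw → map⁺ (All.map (_∷ pw) pV)) (words-All pV n)))

∑-1≡length : ∀ {A : Set} (xs : List A) → ∑ (λ _ → 1) xs ≡ length xs
∑-1≡length xs = trans (∑-const 1 xs) (*-identityˡ (length xs))

length-words : ∀ {A : Set} (V : List A) n → length (words V n) ≡ length V ^ n
length-words V zero    = refl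
length-words V (suc n) = begin
  length (words V (suc n))               ≡⟨ ∑-1≡length (words V (suc n)) ⟨
  ∑ (λ _ → 1) (words V (suc n))          ≡⟨ ∑-words-suc (λ _ → 1) V n ⟩
  ∑ (λ _ → ∑ (λ _ → 1) V) (words V n)    ≡⟨ ∑-const (∑ (λ _ → 1) V) (words V n) ⟩
  ∑ (λ _ → 1) V * length (words V n)     ≡⟨ cong₂ _*_ (∑-1≡length V) (length-words V n) ⟩
  length V * length V ^ n                ∎
  where open ≡-Reasoning

∑-length-words : ∀ {A : Set} (V : List A) n → ∑ length (words V n) ≡ n * length V ^ n
∑-length-words V zero    = refl
∑-length-words V (suc n) = begin
  ∑ length (words V (suc n))                          ≡⟨ ∑-words-suc length V n ⟩
  ∑ (λ w → ∑ (λ _ → suc (length w)) V) (words V n)    ≡⟨ ∑-cong (words V n) (λ w → ∑-const (suc (length w)) V) ⟩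
  ∑ (λ w → suc (length w) * ℓ) (words V n)            ≡⟨ ∑-cong (words V n) (λ w → *-comm (suc (length w)) ℓ) ⟩
  ∑ (λ w → ℓ * suc (length w)) (words V n)            ≡⟨ ∑-*ˡ ℓ (suc ∘ length) (words V n) ⟩
  ℓ * ∑ (λ w → 1 + length w) (words V n)              ≡⟨ cong (ℓ *_) (∑-+ (λ _ → 1) length (words V n)) ⟩
  ℓ * (∑ (λ _ → 1) (words V n) + ∑ length (words V n)) ≡⟨ cong₂ (λ x y → ℓ * (x + y))
                                                          (trans (∑-1≡length (words V n)) (length-words V n))
                                                          (∑-length-words V n) ⟩
  ℓ * (ℓ ^ n + n * ℓ ^ n)                             ≡⟨ lemma ℓ (ℓ ^ n) n ⟩
  suc n * (ℓ * ℓ ^ n)                                 ∎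
  where
  open ≡-Reasoning
  ℓ = length V
  lemma : ∀ a b n → a * (b + n * b) ≡ suc n * (a * b)
  lemma = solve-∀

∑-signedWords-congᴮ : ∀ m n {f g : List ℤ → ℕ} → (∀ w → All (Bounded m) w → f w ≡ g w) →
                      ∑ f (signedWords m n) ≡ ∑ g (signedWords m n)
∑-signedWords-congᴮ m n = ∑-congᴬ (words-All (signedValues-bounded m) n)

-- Sums over words with distinct absolute values

occursAbs : ℤ → List ℤ → Bool
occursAbs a t = any (λ y → ℤ.∣ a ∣ ≡ᵇ ℤ.∣ y ∣) t

fresh : ℤ → List ℤ → Bool
fresh a t = not (occursAbs a t)

∑distinct : ℕ → ℕ → (List ℤ → ℕ) → ℕ
∑distinct m n g = ∑ (λ w → 𝟙 (distinctAbs w) * g w) (signedWords m n)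

∑fresh : ℕ → (List ℤ → ℕ) → List ℤ → ℕ
∑fresh m g t = ∑ (λ a → 𝟙 (fresh a t) * g (a ∷ t)) (signedValues m)

∑distinct-zero : ∀ m g → ∑distinct m 0 g ≡ g []
∑distinct-zero m g = trans (+-identityʳ (1 * g [])) (*-identityˡ (g []))

∑distinct-suc : ∀ m n g → ∑distinct m (suc n) g ≡ ∑distinct m n (∑fresh m g)
∑distinct-suc m n g = trans (∑-words-suc (λ w → 𝟙 (distinctAbs w) * g w) (signedValues m) n)
                            (∑-cong (signedWords m n) factor)
  where
  factor : ∀ w → ∑ (λ a → 𝟙 (distinctAbs (a ∷ w)) * g (a ∷ w)) (signedValues m) ≡ 𝟙 (distinctAbs w) * ∑fresh m g w
  factor w = trans (∑-cong (signedValues m) (λ a → begin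
      𝟙 (fresh a w ∧ distinctAbs w) * g (a ∷ w)        ≡⟨ cong (_* g (a ∷ w)) (𝟙-∧ (fresh a w) (distinctAbs w)) ⟩
      𝟙 (fresh a w) * 𝟙 (distinctAbs w) * g (a ∷ w)    ≡⟨ cong (_* g (a ∷ w)) (*-comm (𝟙 (fresh a w)) _) ⟩
      𝟙 (distinctAbs w) * 𝟙 (fresh a w) * g (a ∷ w)    ≡⟨ *-assoc (𝟙 (distinctAbs w)) _ _ ⟩
      𝟙 (distinctAbs w) * (𝟙 (fresh a w) * g (a ∷ w))  ∎))
    (∑-*ˡ (𝟙 (distinctAbs w)) (λ a → 𝟙 (fresh a w) * g (a ∷ w)) (signedValues m))
    where open ≡-Reasoning

∑distinct-+ : ∀ m n f g → ∑distinct m n (λ w → f w + g w) ≡ ∑distinct m n f + ∑distinct m n g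
∑distinct-+ m n f g = trans (∑-cong (signedWords m n) (λ w → *-distribˡ-+ (𝟙 (distinctAbs w)) (f w) (g w)))
                            (∑-+ _ _ (signedWords m n))

∑distinct-congᴮ : ∀ m n {f g} → (∀ w → All (Bounded m) w → f w ≡ g w) → ∑distinct m n f ≡ ∑distinct m n g
∑distinct-congᴮ m n e = ∑-signedWords-congᴮ m n (λ w bw → cong (𝟙 (distinctAbs w) *_) (e w bw))

insertions insertionsBehindHead : ℕ → List ℤ → List (List ℤ)
insertions m u = (+[1+ m ] ∷ u) ∷ (-[1+ m ] ∷ u) ∷ insertionsBehindHead m u
insertionsBehindHead m []      = []
insertionsBehindHead m (a ∷ u) = map (a ∷_) (insertions m u)

occursAbs-top : ∀ m t → All (Bounded m) t → occursAbs +[1+ m ] t ≡ false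
occursAbs-top m []      []         = refl
occursAbs-top m (y ∷ t) (by ∷ bt) rewrite ≡ᵇ-false {suc m} {ℤ.∣ y ∣} (λ e → <⇒≢ (s≤s by) (sym e)) = occursAbs-top m t bt

record IsInsertion (m : ℕ) (u v : List ℤ) : Set where
  constructor insertion
  field
    sameAbs : ∀ a → Bounded m a → occursAbs a v ≡ occursAbs a u
    hasTop  : occursAbs +[1+ m ] v ≡ true

insertions-IsInsertion : ∀ m u → All (Bounded m) u → All (IsInsertion m u) (insertions m u)
insertionsBehindHead-IsInsertion : ∀ m u → All (Bounded m) u → All (IsInsertion m u) (insertionsBehindHead m u)
insertions-IsInsertion m u bu = atHead +[1+ m ] refl ∷ atHead -[1+ m ] refl ∷ insertionsBehindHead-IsInsertion m u bu
  where
  atHead : ∀ z → ℤ.∣ z ∣ ≡ suc m → IsInsertion m u (z ∷ u)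
  atHead z ∣z∣≡1+m = insertion (λ a ba → cong (_∨ occursAbs a u) (≡ᵇ-false (λ e → <⇒≢ (s≤s ba) (trans e ∣z∣≡1+m))))
                               (cong (_∨ occursAbs +[1+ m ] u) (subst (λ k → (suc m ≡ᵇ k) ≡ true) (sym ∣z∣≡1+m) (≡ᵇ-refl (suc m))))
insertionsBehindHead-IsInsertion m []      []        = []
insertionsBehindHead-IsInsertion m (b ∷ u) (bb ∷ bu) = map⁺ (All.map consᴵ (insertions-IsInsertion m u bu))
  where
  consᴵ : ∀ {v} → IsInsertion m u v → IsInsertion m (b ∷ u) (b ∷ v)
  consᴵ (insertion same top) = insertion (λ a ba → cong (_ ∨_) (same a ba)) (trans (cong (_ ∨_) top) (∨-zeroʳ _))

atTop : ℕ → (List ℤ → ℕ) → List ℤ → ℕ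
atTop m g t = g (+[1+ m ] ∷ t) + g (-[1+ m ] ∷ t)

insertedBehind : ℕ → (List ℤ → ℕ) → List ℤ → ℕ
insertedBehind m g u = ∑ (λ a → 𝟙 (fresh a u) * ∑ (λ v → g (a ∷ v)) (insertions m u)) (signedValues m)

∑fresh-suc : ∀ m g t → All (Bounded m) t → ∑fresh (suc m) g t ≡ ∑fresh m g t + atTop m g t
∑fresh-suc m g t bt = trans (∑-signedValues-suc m (λ a → 𝟙 (fresh a t) * g (a ∷ t)))
  (cong (_+_ (∑fresh m g t)) (cong₂ _+_ (trans (cong (λ o → 𝟙 (not o) * g (+[1+ m ] ∷ t)) (occursAbs-top m t bt)) (*-identityˡ _))
                                         (trans (cong (λ o → 𝟙 (not o) * g (-[1+ m ] ∷ t)) (occursAbs-top m t bt)) (*-identityˡ _))))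

∑-∑fresh-insertions : ∀ m g u → All (Bounded m) u → ∑ (∑fresh (suc m) g) (insertions m u) ≡ insertedBehind m g u
∑-∑fresh-insertions m g u bu = begin
  ∑ (∑fresh (suc m) g) (insertions m u)
    ≡⟨ ∑-congᴬ (insertions-IsInsertion m u bu) ∑fresh-insertion ⟩
  ∑ (λ v → ∑ (λ a → 𝟙 (fresh a u) * g (a ∷ v)) (signedValues m)) (insertions m u)
    ≡⟨ ∑-swap (λ v a → 𝟙 (fresh a u) * g (a ∷ v)) (insertions m u) (signedValues m) ⟩
  ∑ (λ a → ∑ (λ v → 𝟙 (fresh a u) * g (a ∷ v)) (insertions m u)) (signedValues m)
    ≡⟨ ∑-cong (signedValues m) (λ a → ∑-*ˡ (𝟙 (fresh a u)) (λ v → g (a ∷ v)) (insertions m u)) ⟩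
  insertedBehind m g u ∎
  where
  open ≡-Reasoning
  ∑fresh-insertion : ∀ v → IsInsertion m u v → ∑fresh (suc m) g v ≡ ∑ (λ a → 𝟙 (fresh a u) * g (a ∷ v)) (signedValues m)
  ∑fresh-insertion v (insertion same top) = trans (∑-signedValues-suc m (λ a → 𝟙 (fresh a v) * g (a ∷ v)))
    (trans (cong₂ _+_ (∑-congᴬ (signedValues-bounded m) (λ a ba → cong (λ o → 𝟙 (not o) * g (a ∷ v)) (same a ba)))
                      (cong₂ _+_ (cong (λ o → 𝟙 (not o) * g (+[1+ m ] ∷ v)) top) (cong (λ o → 𝟙 (not o) * g (-[1+ m ] ∷ v)) top)))
           (+-identityʳ _))

∑fresh-insertions : ∀ m g u → ∑fresh m (λ t → ∑ g (insertions m t)) u ≡ ∑fresh m (atTop m g) u + insertedBehind m g u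
∑fresh-insertions m g u = trans (∑-cong (signedValues m) (λ a → trans (cong (𝟙 (fresh a u) *_) (insertions-cons a))
                                                                 (*-distribˡ-+ (𝟙 (fresh a u)) (atTop m g (a ∷ u)) _)))
                                (∑-+ _ _ (signedValues m))
  where
  insertions-cons : ∀ a → ∑ g (insertions m (a ∷ u)) ≡ atTop m g (a ∷ u) + ∑ (λ v → g (a ∷ v)) (insertions m u)
  insertions-cons a = trans (sym (+-assoc (g (+[1+ m ] ∷ a ∷ u)) _ _)) (cong (_+_ (atTop m g (a ∷ u))) (∑-map g (a ∷_) (insertions m u)))

-- A word over ±[m+1] either avoids ±(m+1), or arises from exactly one shorter word over ±[m] by inserting ±(m+1).
∑distinct-insert : ∀ m n (g : List ℤ → ℕ) →
  ∑distinct (suc m) (suc n) g ≡ ∑distinct m (suc n) g + ∑distinct m n (λ u → ∑ g (insertions m u))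
∑distinct-insert m zero g = begin
  ∑distinct (suc m) 1 g                          ≡⟨ ∑distinct-suc (suc m) 0 g ⟩
  ∑distinct (suc m) 0 (∑fresh (suc m) g)         ≡⟨ ∑distinct-zero (suc m) (∑fresh (suc m) g) ⟩
  ∑fresh (suc m) g []                            ≡⟨ ∑fresh-suc m g [] [] ⟩
  ∑fresh m g [] + atTop m g []                   ≡⟨ cong (λ x → ∑fresh m g [] + (g (+[1+ m ] ∷ []) + x)) (+-identityʳ _) ⟨
  ∑fresh m g [] + ∑ g (insertions m [])          ≡⟨ cong₂ _+_ (trans (∑distinct-suc m 0 g) (∑distinct-zero m (∑fresh m g)))
                                                              (∑distinct-zero m (λ u → ∑ g (insertions m u))) ⟨
  ∑distinct m 1 g + ∑distinct m 0 (λ u → ∑ g (insertions m u)) ∎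
  where open ≡-Reasoning
∑distinct-insert m (suc n) g = begin
  ∑distinct (suc m) (suc (suc n)) g
    ≡⟨ ∑distinct-suc (suc m) (suc n) g ⟩
  ∑distinct (suc m) (suc n) (∑fresh (suc m) g)
    ≡⟨ ∑distinct-insert m n (∑fresh (suc m) g) ⟩
  ∑distinct m (suc n) (∑fresh (suc m) g) + ∑distinct m n (λ u → ∑ (∑fresh (suc m) g) (insertions m u))
    ≡⟨ cong₂ _+_ (∑distinct-congᴮ m (suc n) (∑fresh-suc m g)) (∑distinct-congᴮ m n (∑-∑fresh-insertions m g)) ⟩
  ∑distinct m (suc n) (λ t → ∑fresh m g t + atTop m g t) + ∑distinct m n (insertedBehind m g)
    ≡⟨ cong (_+ ∑distinct m n (insertedBehind m g)) (∑distinct-+ m (suc n) (∑fresh m g) (atTop m g)) ⟩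
  (∑distinct m (suc n) (∑fresh m g) + ∑distinct m (suc n) (atTop m g)) + ∑distinct m n (insertedBehind m g)
    ≡⟨ +-assoc (∑distinct m (suc n) (∑fresh m g)) _ _ ⟩
  ∑distinct m (suc n) (∑fresh m g) + (∑distinct m (suc n) (atTop m g) + ∑distinct m n (insertedBehind m g))
    ≡⟨ cong₂ _+_ (∑distinct-suc m (suc n) g) (cong (_+ ∑distinct m n (insertedBehind m g)) (sym (∑distinct-suc m n (atTop m g)))) ⟨
  ∑distinct m (suc (suc n)) g + (∑distinct m n (∑fresh m (atTop m g)) + ∑distinct m n (insertedBehind m g))
    ≡⟨ cong (_+_ (∑distinct m (suc (suc n)) g)) (∑distinct-+ m n (∑fresh m (atTop m g)) (insertedBehind m g)) ⟨
  ∑distinct m (suc (suc n)) g + ∑distinct m n (λ u → ∑fresh m (atTop m g) u + insertedBehind m g u)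
    ≡⟨ cong (_+_ (∑distinct m (suc (suc n)) g)) (∑distinct-congᴮ m n (λ u _ → ∑fresh-insertions m g u)) ⟨
  ∑distinct m (suc (suc n)) g + ∑distinct m n (∑fresh m (λ t → ∑ g (insertions m t)))
    ≡⟨ cong (_+_ (∑distinct m (suc (suc n)) g)) (∑distinct-suc m n (λ t → ∑ g (insertions m t))) ⟨
  ∑distinct m (suc (suc n)) g + ∑distinct m (suc n) (λ t → ∑ g (insertions m t)) ∎
  where open ≡-Reasoning

-- Profiles

isNeg : ℤ → Bool
isNeg (+ _)    = false
isNeg -[1+ _ ] = true

infix 5 _>ᵇ_

_>ᵇ_ : ℤ → ℤ → Bool
a >ᵇ b = if b ℤ.≤ᵇ a then not (a ℤ.≤ᵇ b) else false

descents-cons₂ : ∀ a b t → descents (a ∷ b ∷ t) ≡ 𝟙 (a >ᵇ b) + descents (b ∷ t)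
descents-cons₂ a b t with b ℤ.≤ᵇ a | a ℤ.≤ᵇ b
... | true  | true  = refl
... | true  | false = refl
... | false | _     = refl

Profile : Set
Profile = List (Bool × Bool)

-- Position i of the profile records (wᵢ < 0, wᵢ > wᵢ₊₁); the descent flag of the last position is false.
profile : List ℤ → Profile
profile []          = []
profile (a ∷ [])    = (isNeg a , false) ∷ []
profile (a ∷ b ∷ w) = (isNeg a , a >ᵇ b) ∷ profile (b ∷ w)

headDescent : ℤ → List ℤ → Bool
headDescent a []      = false
headDescent a (b ∷ _) = a >ᵇ b

profile-cons : ∀ a u → profile (a ∷ u) ≡ (isNeg a , headDescent a u) ∷ profile u
profile-cons a []      = refl
profile-cons a (b ∷ u) = refl

nonEmpty : Profile → Bool
nonEmpty []      = false
nonEmpty (_ ∷ _) = true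

insertTopᴾ insertBottomᴾ : Profile → Profile
insertTopᴾ P    = (false , nonEmpty P) ∷ P
insertBottomᴾ P = (true , false) ∷ P

insertionsᴾ insertionsBehindHeadᴾ : Profile → List Profile
insertionsᴾ P = insertTopᴾ P ∷ insertBottomᴾ P ∷ insertionsBehindHeadᴾ P
insertionsBehindHeadᴾ []            = []
insertionsBehindHeadᴾ ((s , d) ∷ P) = ((s , false) ∷ insertTopᴾ P) ∷ ((s , true) ∷ insertBottomᴾ P)
                                      ∷ map ((s , d) ∷_) (insertionsBehindHeadᴾ P)

module _ (m : ℕ) where

  top>ᵇ : ∀ b → Bounded m b → +[1+ m ] >ᵇ b ≡ true
  top>ᵇ (+ k)    bk rewrite ≤ᵇ-true {k} {suc m} (m≤n⇒m≤1+n bk) | ≤ᵇ-false {suc m} {k} (s≤s bk) = refl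
  top>ᵇ -[1+ k ] bk = refl

  bottom>ᵇ : ∀ b → Bounded m b → -[1+ m ] >ᵇ b ≡ false
  bottom>ᵇ (+ k)    bk = refl
  bottom>ᵇ -[1+ k ] bk rewrite ≤ᵇ-false {m} {k} bk = refl

  >ᵇ-top : ∀ a → Bounded m a → a >ᵇ +[1+ m ] ≡ false
  >ᵇ-top (+ k)    bk rewrite ≤ᵇ-false {suc m} {k} (s≤s bk) = refl
  >ᵇ-top -[1+ k ] bk = refl

  >ᵇ-bottom : ∀ a → Bounded m a → a >ᵇ -[1+ m ] ≡ true
  >ᵇ-bottom (+ k)    bk = refl
  >ᵇ-bottom -[1+ k ] bk rewrite ≤ᵇ-true {k} {m} (≤-trans (n≤1+n k) bk) | ≤ᵇ-false {m} {k} bk = refl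

  profile-insertTop : ∀ u → All (Bounded m) u → profile (+[1+ m ] ∷ u) ≡ insertTopᴾ (profile u)
  profile-insertTop []          _        = refl
  profile-insertTop (b ∷ [])    (bb ∷ _) rewrite top>ᵇ b bb = refl
  profile-insertTop (b ∷ c ∷ u) (bb ∷ _) rewrite top>ᵇ b bb = refl

  profile-insertBottom : ∀ u → All (Bounded m) u → profile (-[1+ m ] ∷ u) ≡ insertBottomᴾ (profile u)
  profile-insertBottom []      _        = refl
  profile-insertBottom (b ∷ u) (bb ∷ _) rewrite bottom>ᵇ b bb | profile-cons b u = refl

  profile-insertionsBehindHead : ∀ u → All (Bounded m) u → map profile (insertionsBehindHead m u) ≡ insertionsBehindHeadᴾ (profile u)
  profile-insertionsBehindHead []      []        = refl
  profile-insertionsBehindHead (a ∷ u) (ba ∷ bu) = begin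
    map profile (insertionsBehindHead m (a ∷ u))
      ≡⟨⟩
    profile (a ∷ +[1+ m ] ∷ u) ∷ profile (a ∷ -[1+ m ] ∷ u) ∷ map profile (map (a ∷_) (insertionsBehindHead m u))
      ≡⟨ cong₂ _∷_ atSecondTop (cong₂ _∷_ atSecondBottom
           (trans (profile-cons-behindHead u) (cong (map ((isNeg a , headDescent a u) ∷_)) (profile-insertionsBehindHead u bu)))) ⟩
    insertionsBehindHeadᴾ ((isNeg a , headDescent a u) ∷ profile u)
      ≡⟨ cong insertionsBehindHeadᴾ (profile-cons a u) ⟨
    insertionsBehindHeadᴾ (profile (a ∷ u)) ∎
    where
    open ≡-Reasoning
    atSecondTop : profile (a ∷ +[1+ m ] ∷ u) ≡ (isNeg a , false) ∷ insertTopᴾ (profile u)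
    atSecondTop rewrite >ᵇ-top a ba = cong (_ ∷_) (profile-insertTop u bu)
    atSecondBottom : profile (a ∷ -[1+ m ] ∷ u) ≡ (isNeg a , true) ∷ insertBottomᴾ (profile u)
    atSecondBottom rewrite >ᵇ-bottom a ba = cong (_ ∷_) (profile-insertBottom u bu)
    profile-cons-behindHead : ∀ u → map profile (map (a ∷_) (insertionsBehindHead m u))
                                  ≡ map ((isNeg a , headDescent a u) ∷_) (map profile (insertionsBehindHead m u))
    profile-cons-behindHead []      = refl
    profile-cons-behindHead (b ∷ u) = go (insertions m u)
      where
      go : ∀ vs → map profile (map (a ∷_) (map (b ∷_) vs)) ≡ map ((isNeg a , a >ᵇ b) ∷_) (map profile (map (b ∷_) vs))
      go []       = refl
      go (v ∷ vs) = cong (_ ∷_) (go vs)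

  profile-insertions : ∀ u → All (Bounded m) u → map profile (insertions m u) ≡ insertionsᴾ (profile u)
  profile-insertions u bu = cong₂ _∷_ (profile-insertTop u bu) (cong₂ _∷_ (profile-insertBottom u bu) (profile-insertionsBehindHead u bu))

binomial : ℕ → ℕ → ℕ
binomial m       zero    = 1
binomial zero    (suc n) = 0
binomial (suc m) (suc n) = binomial m (suc n) + binomial m n

binomial-< : ∀ m n → m < n → binomial m n ≡ 0
binomial-< zero    (suc n) _         = refl
binomial-< (suc m) (suc n) (s≤s m<n) rewrite binomial-< m (suc n) (m≤n⇒m≤1+n m<n) | binomial-< m n m<n = refl

binomial-diag : ∀ n → binomial n n ≡ 1
binomial-diag zero    = refl
binomial-diag (suc n) rewrite binomial-< n (suc n) ≤-refl | binomial-diag n = refl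

-- The sum of f over the profiles of the elements of 𝔅ₙ, generated by successively inserting ±1, ±2, …, ±n.
∑𝔅 : ℕ → (Profile → ℕ) → ℕ
∑𝔅 zero    f = f []
∑𝔅 (suc n) f = ∑𝔅 n (λ P → ∑ f (insertionsᴾ P))

∑𝔅-cong : ∀ n {f g} → (∀ P → f P ≡ g P) → ∑𝔅 n f ≡ ∑𝔅 n g
∑𝔅-cong zero    e = e []
∑𝔅-cong (suc n) e = ∑𝔅-cong n (λ P → ∑-cong (insertionsᴾ P) e)

-- A word with distinct absolute values is a choice of n of the m absolute values together with an element of 𝔅ₙ
-- with the same profile.
∑distinct-profile : ∀ n f m → ∑distinct m n (f ∘ profile) ≡ binomial m n * ∑𝔅 n f
∑distinct-profile zero    f m       = trans (∑distinct-zero m (f ∘ profile)) (sym (+-identityʳ (f [])))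
∑distinct-profile (suc n) f zero    = trans (∑distinct-suc 0 n (f ∘ profile))
  (trans (∑-cong (signedWords 0 n) (λ w → *-zeroʳ (𝟙 (distinctAbs w)))) (∑-const 0 (signedWords 0 n)))
∑distinct-profile (suc n) f (suc m) = begin
  ∑distinct (suc m) (suc n) (f ∘ profile)
    ≡⟨ ∑distinct-insert m n (f ∘ profile) ⟩
  ∑distinct m (suc n) (f ∘ profile) + ∑distinct m n (λ u → ∑ (f ∘ profile) (insertions m u))
    ≡⟨ cong (_+_ (∑distinct m (suc n) (f ∘ profile))) (∑distinct-congᴮ m n (λ u bu →
         trans (sym (∑-map f profile (insertions m u))) (cong (∑ f) (profile-insertions m u bu)))) ⟩
  ∑distinct m (suc n) (f ∘ profile) + ∑distinct m n (f⁺ ∘ profile)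
    ≡⟨ cong₂ _+_ (∑distinct-profile (suc n) f m) (∑distinct-profile n f⁺ m) ⟩
  binomial m (suc n) * ∑𝔅 (suc n) f + binomial m n * ∑𝔅 (suc n) f
    ≡⟨ *-distribʳ-+ (∑𝔅 (suc n) f) (binomial m (suc n)) (binomial m n) ⟨
  binomial (suc m) (suc n) * ∑𝔅 (suc n) f ∎
  where
  open ≡-Reasoning
  f⁺ : Profile → ℕ
  f⁺ P = ∑ f (insertionsᴾ P)

∑𝔅-profile : ∀ n f → ∑distinct n n (f ∘ profile) ≡ ∑𝔅 n f
∑𝔅-profile n f = trans (∑distinct-profile n f n) (trans (cong (_* ∑𝔅 n f) (binomial-diag n)) (*-identityˡ _))

-- Lattice chains and their encoding by words

-- Listing ±[m] increasingly identifies it with [0, 2m).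
valueOfRank : ℕ → ℕ → ℤ
valueOfRank m r = if r <ᵇ m then -[1+ (m ∸ suc r) ] else +[1+ (r ∸ m) ]

rankOffset : ℕ → ℤ → ℕ
rankOffset m (+ k)    = k ∸ 1
rankOffset m -[1+ k ] = m ∸ suc k

rank : ℕ → ℤ → ℕ
rank m z = 𝟙 (not (isNeg z)) * m + rankOffset m z

valueOfRank-< : ∀ m r → r < m → valueOfRank m r ≡ -[1+ (m ∸ suc r) ]
valueOfRank-< m r r<m rewrite <ᵇ-true r<m = refl

valueOfRank-≥ : ∀ m r → m ≤ r → valueOfRank m r ≡ +[1+ (r ∸ m) ]
valueOfRank-≥ m r m≤r rewrite <ᵇ-false {r} {m} m≤r = refl

rank-valueOfRank : ∀ m r → rank m (valueOfRank m r) ≡ r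
rank-valueOfRank m r with r <? m
... | yes r<m rewrite valueOfRank-< m r r<m = trans (cong (m ∸_) (sym (+-∸-assoc 1 r<m))) (m∸[m∸n]≡n (<⇒≤ r<m))
... | no r≮m  rewrite valueOfRank-≥ m r (≮⇒≥ r≮m) = trans (cong (_+ (r ∸ m)) (+-identityʳ m)) (m+[n∸m]≡n (≮⇒≥ r≮m))

isNeg-valueOfRank : ∀ m r → isNeg (valueOfRank m r) ≡ (r <ᵇ m)
isNeg-valueOfRank m r with r <? m
... | yes r<m rewrite valueOfRank-< m r r<m | <ᵇ-true r<m = refl
... | no r≮m  rewrite valueOfRank-≥ m r (≮⇒≥ r≮m) | <ᵇ-false {r} {m} (≮⇒≥ r≮m) = refl

valueOfRank-≤ᵇ : ∀ m a b → (valueOfRank m a ℤ.≤ᵇ valueOfRank m b) ≡ (a ≤ᵇ b)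
valueOfRank-≤ᵇ m a b with a <? m | b <? m
... | yes a<m | yes b<m rewrite valueOfRank-< m a a<m | valueOfRank-< m b b<m =
  ≤ᵇ-≡ (λ le → ≮⇒≥ (λ b<a → <⇒≱ (∸-monoʳ-< (s≤s b<a) a<m) le)) (λ a≤b → ∸-monoʳ-≤ m (s≤s a≤b))
... | yes a<m | no b≮m rewrite valueOfRank-< m a a<m | valueOfRank-≥ m b (≮⇒≥ b≮m) =
  sym (≤ᵇ-true (≤-trans (<⇒≤ a<m) (≮⇒≥ b≮m)))
... | no a≮m | yes b<m rewrite valueOfRank-≥ m a (≮⇒≥ a≮m) | valueOfRank-< m b b<m =
  sym (≤ᵇ-false (<-≤-trans b<m (≮⇒≥ a≮m)))
... | no a≮m | no b≮m rewrite valueOfRank-≥ m a (≮⇒≥ a≮m) | valueOfRank-≥ m b (≮⇒≥ b≮m) =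
  ≤ᵇ-≡ (λ le → begin
          a             ≡⟨ m∸n+n≡m (≮⇒≥ a≮m) ⟨
          a ∸ m + m     ≤⟨ +-monoˡ-≤ m (≤-pred le) ⟩
          b ∸ m + m     ≡⟨ m∸n+n≡m (≮⇒≥ b≮m) ⟩
          b             ∎)
       (λ a≤b → s≤s (∸-monoˡ-≤ m a≤b))
  where open ≤-Reasoning

valueOfRank->ᵇ : ∀ m r r′ → (valueOfRank m r >ᵇ valueOfRank m r′) ≡ (r′ <ᵇ r)
valueOfRank->ᵇ m r r′ rewrite valueOfRank-≤ᵇ m r′ r | valueOfRank-≤ᵇ m r r′ with <-cmp r′ r
... | tri< r′<r _ _ rewrite ≤ᵇ-true (<⇒≤ r′<r) | ≤ᵇ-false {r} {r′} r′<r | <ᵇ-true r′<r = refl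
... | tri≈ _ refl _ rewrite ≤ᵇ-true (≤-refl {r}) | <ᵇ-false {r} {r} ≤-refl = refl
... | tri> _ _ r<r′ rewrite ≤ᵇ-false {r′} {r} r<r′ | <ᵇ-false {r′} {r} (<⇒≤ r<r′) = refl

∑-signedValues-byRank : ∀ m (h : ℤ → ℕ) → ∑ h (signedValues m) ≡ ∑< (2 * m) (h ∘ valueOfRank m)
∑-signedValues-byRank m h = begin
  ∑ h (signedValues m)                                            ≡⟨ ∑-signedValues m h ⟩
  ∑< m (h ∘ +[1+_]) + ∑< m (h ∘ -[1+_])               ≡⟨ +-comm (∑< m (h ∘ +[1+_])) _ ⟩
  ∑< m (h ∘ -[1+_]) + ∑< m (h ∘ +[1+_])
    ≡⟨ cong₂ _+_ (trans (sym (∑<-reverse m (h ∘ -[1+_]))) (∑<-cong m (λ r r<m → cong h (sym (valueOfRank-< m r r<m)))))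
                 (∑<-cong m (λ i _ → cong h (trans (cong +[1+_] (sym (m+n∸m≡n m i))) (sym (valueOfRank-≥ m (m + i) (m≤m+n m i)))))) ⟩
  ∑< m (h ∘ valueOfRank m) + ∑< m (λ i → h (valueOfRank m (m + i))) ≡⟨ ∑<-+-length m m (h ∘ valueOfRank m) ⟨
  ∑< (m + m) (h ∘ valueOfRank m)                                    ≡⟨ cong (λ k → ∑< (m + k) (h ∘ valueOfRank m)) (+-identityʳ m) ⟨
  ∑< (2 * m) (h ∘ valueOfRank m)                                    ∎
  where open ≡-Reasoning

halfOpenChains : ℕ → ℕ → ℕ → ℕ → ℕ → ℕ
halfOpenChains m lo hi zero    a = 𝟙 ((lo ≤ᵇ a) ∧ (suc a ≤ᵇ hi))
halfOpenChains m lo hi (suc n) a = ∑< (2 * m) (λ i → halfOpenChains m lo hi n (a + i))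

halfOpenChains-shift : ∀ m lo hi n a s → halfOpenChains m (lo + s) (hi + s) n (a + s) ≡ halfOpenChains m lo hi n a
halfOpenChains-shift m lo hi zero    a s = cong₂ (λ x y → 𝟙 (x ∧ y))
  (≤ᵇ-≡ (+-cancelʳ-≤ s lo a) (+-monoˡ-≤ s))
  (≤ᵇ-≡ (+-cancelʳ-≤ s (suc a) hi) (+-monoˡ-≤ s))
halfOpenChains-shift m lo hi (suc n) a s = ∑<-cong (2 * m) (λ i _ →
  trans (cong (halfOpenChains m (lo + s) (hi + s) n) (lemma a s i)) (halfOpenChains-shift m lo hi n (a + i) s))
  where
  lemma : ∀ a s i → a + s + i ≡ a + i + s
  lemma = solve-∀

halfOpenChains-split : ∀ m lo mid hi n a → lo ≤ mid → mid ≤ hi →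
  halfOpenChains m lo hi n a ≡ halfOpenChains m lo mid n a + halfOpenChains m mid hi n a
halfOpenChains-split m lo mid hi zero a lo≤mid mid≤hi with a <? mid
... | yes a<mid rewrite ≤ᵇ-true {suc a} {mid} a<mid | ≤ᵇ-true {suc a} {hi} (≤-trans a<mid mid≤hi) | ≤ᵇ-false {mid} {a} a<mid =
  sym (+-identityʳ _)
... | no a≮mid rewrite ≤ᵇ-false {suc a} {mid} (s≤s (≮⇒≥ a≮mid)) | ≤ᵇ-true {mid} {a} (≮⇒≥ a≮mid)
                     | ≤ᵇ-true {lo} {a} (≤-trans lo≤mid (≮⇒≥ a≮mid)) =
  refl
halfOpenChains-split m lo mid hi (suc n) a lo≤mid mid≤hi =
  trans (∑<-cong (2 * m) (λ i _ → halfOpenChains-split m lo mid hi n (a + i) lo≤mid mid≤hi)) (∑<-+ (2 * m) _ _)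

∑-signedWords-byFirstRank : ∀ m n (f : List ℤ → ℕ) →
  ∑ f (signedWords m (suc n)) ≡ ∑< (2 * m) (λ r → ∑ (λ t → f (valueOfRank m r ∷ t)) (signedWords m n))
∑-signedWords-byFirstRank m n f = trans (∑-words-suc f (signedValues m) n)
  (trans (∑-swap (λ t a → f (a ∷ t)) (signedWords m n) (signedValues m)) (∑-signedValues-byRank m _))

∑<-double : ∀ m (f : ℕ → ℕ) → ∑< (2 * m) f ≡ ∑< m f + ∑< m (λ i → f (m + i))
∑<-double m f = trans (cong (λ k → ∑< (m + k) f) (+-identityʳ m)) (∑<-+-length m m f)

lastOf : ℤ → List ℤ → ℤ
lastOf a []      = a
lastOf a (b ∷ t) = lastOf b t

headNeg : List ℤ → Bool
headNeg []      = false
headNeg (a ∷ _) = isNeg a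

lastLetter : List ℤ → ℤ
lastLetter []      = + 0
lastLetter (a ∷ t) = lastOf a t

module ChainEncoding (m lo hi : ℕ) where

  endpointIn : ℕ → ℤ → ℕ
  endpointIn c z = 𝟙 ((lo ≤ᵇ (2 * m * c + rank m z)) ∧ (suc (2 * m * c + rank m z) ≤ᵇ hi))

  wordChains : ℕ → ℕ → ℕ → ℕ
  wordChains n r c = ∑ (λ t → endpointIn (c + descents (valueOfRank m r ∷ t)) (lastOf (valueOfRank m r) t)) (signedWords m n)

  wordChains-suc : ∀ n r c → wordChains (suc n) r c ≡ ∑< (2 * m) (λ r′ → wordChains n r′ (c + 𝟙 (r′ <ᵇ r)))
  wordChains-suc n r c = begin
    wordChains (suc n) r c
      ≡⟨ ∑-signedWords-byFirstRank m n (λ t → endpointIn (c + descents (z ∷ t)) (lastOf z t)) ⟩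
    ∑< (2 * m) (λ r′ → ∑ (λ t → endpointIn (c + descents (z ∷ valueOfRank m r′ ∷ t)) (lastOf (valueOfRank m r′) t)) (signedWords m n))
      ≡⟨ ∑<-cong (2 * m) (λ r′ _ → ∑-cong (signedWords m n) (λ t →
           cong (λ d → endpointIn d (lastOf (valueOfRank m r′) t)) (carry r′ t))) ⟩
    ∑< (2 * m) (λ r′ → wordChains n r′ (c + 𝟙 (r′ <ᵇ r))) ∎
    where
    open ≡-Reasoning
    z = valueOfRank m r
    carry : ∀ r′ t → c + descents (z ∷ valueOfRank m r′ ∷ t) ≡ (c + 𝟙 (r′ <ᵇ r)) + descents (valueOfRank m r′ ∷ t)
    carry r′ t = begin
      c + descents (z ∷ valueOfRank m r′ ∷ t)                    ≡⟨ cong (_+_ c) (descents-cons₂ z (valueOfRank m r′) t) ⟩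
      c + (𝟙 (z >ᵇ valueOfRank m r′) + descents (valueOfRank m r′ ∷ t)) ≡⟨ cong (λ b → c + (𝟙 b + _)) (valueOfRank->ᵇ m r r′) ⟩
      c + (𝟙 (r′ <ᵇ r) + descents (valueOfRank m r′ ∷ t))        ≡⟨ +-assoc c _ _ ⟨
      (c + 𝟙 (r′ <ᵇ r)) + descents (valueOfRank m r′ ∷ t)        ∎

  -- The residues r + i (mod 2m), i < 2m, run through [0, 2m) once; the quotient grows by one exactly when the residue drops.
  halfOpenChains-carry : ∀ n r c → r < 2 * m →
    ∑< (2 * m) (λ i → halfOpenChains m lo hi n (2 * m * c + r + i)) ≡
    ∑< (2 * m) (λ r′ → halfOpenChains m lo hi n (2 * m * (c + 𝟙 (r′ <ᵇ r)) + r′))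
  halfOpenChains-carry n r c r<2m = begin
    ∑< (2 * m) F                               ≡⟨ cong (λ k → ∑< k F) (trans 2m≡r+d (+-comm r d)) ⟩
    ∑< (d + r) F                               ≡⟨ ∑<-+-length d r F ⟩
    ∑< d F + ∑< r (λ i → F (d + i))            ≡⟨ +-comm (∑< d F) _ ⟩
    ∑< r (λ i → F (d + i)) + ∑< d F            ≡⟨ cong₂ _+_ (∑<-cong r wrapped) (∑<-cong d unwrapped) ⟩
    ∑< r G + ∑< d (λ i → G (r + i))            ≡⟨ ∑<-+-length r d G ⟨
    ∑< (r + d) G                               ≡⟨ cong (λ k → ∑< k G) 2m≡r+d ⟨
    ∑< (2 * m) G                               ∎
    where
    open ≡-Reasoning
    F G : ℕ → ℕ
    F i  = halfOpenChains m lo hi n (2 * m * c + r + i)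
    G r′ = halfOpenChains m lo hi n (2 * m * (c + 𝟙 (r′ <ᵇ r)) + r′)
    d : ℕ
    d = 2 * m ∸ r
    2m≡r+d : 2 * m ≡ r + d
    2m≡r+d = sym (m+[n∸m]≡n (<⇒≤ r<2m))
    wrapped : ∀ i → i < r → F (d + i) ≡ G i
    wrapped i i<r rewrite <ᵇ-true i<r = cong (halfOpenChains m lo hi n) (begin
      2 * m * c + r + (d + i)    ≡⟨ lemma (2 * m * c) r d i ⟩
      2 * m * c + (r + d) + i    ≡⟨ cong (λ k → 2 * m * c + k + i) 2m≡r+d ⟨
      2 * m * c + 2 * m + i      ≡⟨ cong (_+ i) (lemma′ (2 * m) c) ⟩
      2 * m * (c + 1) + i        ∎)
      where
      lemma : ∀ a b c d → a + b + (c + d) ≡ a + (b + c) + d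
      lemma = solve-∀
      lemma′ : ∀ a c → a * c + a ≡ a * (c + 1)
      lemma′ = solve-∀
    unwrapped : ∀ i → i < d → F i ≡ G (r + i)
    unwrapped i _ rewrite <ᵇ-false {r + i} {r} (m≤m+n r i) = cong (halfOpenChains m lo hi n) (lemma (2 * m) c r i)
      where
      lemma : ∀ a c r i → a * c + r + i ≡ a * (c + 0) + (r + i)
      lemma = solve-∀

  halfOpenChains≡wordChains : ∀ n r c → r < 2 * m → halfOpenChains m lo hi n (2 * m * c + r) ≡ wordChains n r c
  halfOpenChains≡wordChains zero    r c _ = sym (trans (+-identityʳ _)
    (cong₂ (λ x y → 𝟙 ((lo ≤ᵇ (2 * m * x + y)) ∧ (suc (2 * m * x + y) ≤ᵇ hi))) (+-identityʳ c) (rank-valueOfRank m r)))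
  halfOpenChains≡wordChains (suc n) r c r<2m = begin
    ∑< (2 * m) (λ i → halfOpenChains m lo hi n (2 * m * c + r + i))                  ≡⟨ halfOpenChains-carry n r c r<2m ⟩
    ∑< (2 * m) (λ r′ → halfOpenChains m lo hi n (2 * m * (c + 𝟙 (r′ <ᵇ r)) + r′))    ≡⟨ ∑<-cong (2 * m) (λ r′ r′<2m →
                                                                                         halfOpenChains≡wordChains n r′ _ r′<2m) ⟩
    ∑< (2 * m) (λ r′ → wordChains n r′ (c + 𝟙 (r′ <ᵇ r)))                              ≡⟨ wordChains-suc n r c ⟨
    wordChains (suc n) r c                                                             ∎
    where open ≡-Reasoning

  halfOpenChains-fromNegatives : ∀ n → ∑< m (halfOpenChains m lo hi n) ≡
    ∑ (λ w → 𝟙 (headNeg w) * endpointIn (descents w) (lastLetter w)) (signedWords m (suc n))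
  halfOpenChains-fromNegatives n = sym (begin
    ∑ (λ w → 𝟙 (headNeg w) * endpointIn (descents w) (lastLetter w)) (signedWords m (suc n))
      ≡⟨ ∑-signedWords-byFirstRank m n _ ⟩
    ∑< (2 * m) (λ r → ∑ (λ t → 𝟙 (isNeg (valueOfRank m r)) * endFrom r t) (signedWords m n))
      ≡⟨ ∑<-cong (2 * m) (λ r _ → trans (∑-*ˡ (𝟙 (isNeg (valueOfRank m r))) (endFrom r) (signedWords m n))
                                         (cong (λ b → 𝟙 b * wordChains n r 0) (isNeg-valueOfRank m r))) ⟩
    ∑< (2 * m) (λ r → 𝟙 (r <ᵇ m) * wordChains n r 0)
      ≡⟨ ∑<-double m _ ⟩
    ∑< m (λ r → 𝟙 (r <ᵇ m) * wordChains n r 0) + ∑< m (λ i → 𝟙 (m + i <ᵇ m) * wordChains n (m + i) 0)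
      ≡⟨ cong₂ _+_ (∑<-cong m (λ r r<m → trans (cong (λ b → 𝟙 b * wordChains n r 0) (<ᵇ-true r<m)) (+-identityʳ _)))
                   (trans (∑<-cong m (λ i _ → cong (λ b → 𝟙 b * wordChains n (m + i) 0) (<ᵇ-false (m≤m+n m i)))) (∑<-zero m)) ⟩
    ∑< m (λ r → wordChains n r 0) + 0
      ≡⟨ +-identityʳ _ ⟩
    ∑< m (λ r → wordChains n r 0)
      ≡⟨ ∑<-cong m (λ r r<m → trans (sym (halfOpenChains≡wordChains n r 0 (≤-trans r<m (m≤m+n m _))))
                                     (cong (λ a → halfOpenChains m lo hi n (a + r)) (*-zeroʳ (2 * m)))) ⟩
    ∑< m (halfOpenChains m lo hi n) ∎)
    where
    open ≡-Reasoning
    endFrom : ℕ → List ℤ → ℕ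
    endFrom r t = endpointIn (descents (valueOfRank m r ∷ t)) (lastOf (valueOfRank m r) t)

  -- Starting in [m, 3m) plays the role of the letter w₀ = 0: the first carry occurs iff w₁ < 0.
  halfOpenChains-fromMiddle : ∀ n → ∑< (2 * m) (λ a → halfOpenChains m lo hi n (m + a)) ≡
    ∑ (λ w → endpointIn (𝟙 (headNeg w) + descents w) (lastLetter w)) (signedWords m (suc n))
  halfOpenChains-fromMiddle n = sym (begin
    ∑ (λ w → endpointIn (𝟙 (headNeg w) + descents w) (lastLetter w)) (signedWords m (suc n))
      ≡⟨ ∑-signedWords-byFirstRank m n _ ⟩
    ∑< (2 * m) (λ r → wordChains n r (𝟙 (isNeg (valueOfRank m r))))
      ≡⟨ ∑<-cong (2 * m) (λ r r<2m → trans (cong (λ b → wordChains n r (𝟙 b)) (isNeg-valueOfRank m r))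
                                           (sym (halfOpenChains≡wordChains n r _ r<2m))) ⟩
    ∑< (2 * m) (λ r → W (2 * m * 𝟙 (r <ᵇ m) + r))
      ≡⟨ ∑<-double m _ ⟩
    ∑< m (λ r → W (2 * m * 𝟙 (r <ᵇ m) + r)) + ∑< m (λ i → W (2 * m * 𝟙 (m + i <ᵇ m) + (m + i)))
      ≡⟨ cong₂ _+_ (∑<-cong m (λ r r<m → cong (λ b → W (2 * m * 𝟙 b + r)) (<ᵇ-true r<m)))
                   (∑<-cong m (λ i _ → cong (λ b → W (2 * m * 𝟙 b + (m + i))) (<ᵇ-false (m≤m+n m i)))) ⟩
    ∑< m (λ r → W (2 * m * 1 + r)) + ∑< m (λ i → W (2 * m * 0 + (m + i)))
      ≡⟨ cong₂ _+_ (∑<-cong m (λ r _ → cong W (lemma₁ m r))) (∑<-cong m (λ i _ → cong W (lemma₀ m i))) ⟩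
    ∑< m (λ r → W (m + (m + r))) + ∑< m (λ i → W (m + i))
      ≡⟨ +-comm (∑< m (λ r → W (m + (m + r)))) _ ⟩
    ∑< m (λ i → W (m + i)) + ∑< m (λ r → W (m + (m + r)))
      ≡⟨ ∑<-double m (λ a → W (m + a)) ⟨
    ∑< (2 * m) (λ a → W (m + a)) ∎)
    where
    open ≡-Reasoning
    W = halfOpenChains m lo hi n
    lemma₁ : ∀ m r → 2 * m * 1 + r ≡ m + (m + r)
    lemma₁ = solve-∀
    lemma₀ : ∀ m i → 2 * m * 0 + (m + i) ≡ m + i
    lemma₀ = solve-∀

-- Profile statistics

firstNegᴾ : Profile → Bool
firstNegᴾ []            = false
firstNegᴾ ((s , _) ∷ _) = s

lastNegᴾ : Profile → Bool
lastNegᴾ []                  = false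
lastNegᴾ ((s , _) ∷ [])      = s
lastNegᴾ (_ ∷ P@(_ ∷ _))     = lastNegᴾ P

descentsᴾ : Profile → ℕ
descentsᴾ []            = 0
descentsᴾ ((_ , d) ∷ P) = 𝟙 d + descentsᴾ P

desBᴾ : Profile → ℕ
desBᴾ P = 𝟙 (firstNegᴾ P) + descentsᴾ P

-- A chain with c carries ending at the last letter of P ends in [slab c P · m, (slab c P + 1) · m).
slab : ℕ → Profile → ℕ
slab c P = 2 * c + 𝟙 (not (lastNegᴾ P))

volumeWeight : ℕ → Profile → ℕ
volumeWeight q P = 𝟙 (firstNegᴾ P) * 𝟙 ((q ≤ᵇ slab (descentsᴾ P) P) ∧ (suc (slab (descentsᴾ P) P) ≤ᵇ suc q))

desBSlabs : ℕ → Profile → ℕ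
desBSlabs k P = 𝟙 ((2 * k ≤ᵇ slab (desBᴾ P) P) ∧ (suc (slab (desBᴾ P) P) ≤ᵇ 2 * k + 2))

hasDesB : ℕ → Profile → ℕ
hasDesB k P = 𝟙 (desBᴾ P ≡ᵇ k)

volumeWeight≤1 : ∀ q P → volumeWeight q P ≤ 1
volumeWeight≤1 q P = ≤-trans (*-monoʳ-≤ (𝟙 (firstNegᴾ P)) (𝟙≤1 _)) (≤-trans (≤-reflexive (*-identityʳ (𝟙 (firstNegᴾ P)))) (𝟙≤1 _))

desBSlabs≡hasDesB : ∀ k P → desBSlabs k P ≡ hasDesB k P
desBSlabs≡hasDesB k P = go (desBᴾ P) (𝟙 (not (lastNegᴾ P))) (𝟙≤1 _)
  where
  open ≤-Reasoning
  below : ∀ d s → s ≤ 1 → d < k → 2 * d + s < 2 * k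
  below d s s≤1 d<k = begin-strict
    2 * d + s      ≤⟨ +-monoʳ-≤ (2 * d) s≤1 ⟩
    2 * d + 1      <⟨ ≤-reflexive (lemma d) ⟩
    2 * suc d      ≤⟨ *-monoʳ-≤ 2 d<k ⟩
    2 * k          ∎
    where
    lemma : ∀ d → suc (2 * d + 1) ≡ 2 * suc d
    lemma = solve-∀
  within : ∀ d s → s ≤ 1 → suc (2 * d + s) ≤ 2 * d + 2
  within d s s≤1 = ≤-trans (≤-reflexive (trans (+-comm 1 (2 * d + s)) (+-assoc (2 * d) s 1))) (+-monoʳ-≤ (2 * d) (+-monoˡ-≤ 1 s≤1))
  above : ∀ d s → k < d → 2 * k + 2 < suc (2 * d + s)
  above d s k<d = s≤s (begin
    2 * k + 2      ≡⟨ +-comm (2 * k) 2 ⟩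
    2 + 2 * k      ≡⟨ *-suc 2 k ⟨
    2 * suc k      ≤⟨ *-monoʳ-≤ 2 k<d ⟩
    2 * d          ≤⟨ m≤m+n (2 * d) s ⟩
    2 * d + s      ∎)
  go : ∀ d s → s ≤ 1 → 𝟙 ((2 * k ≤ᵇ 2 * d + s) ∧ (suc (2 * d + s) ≤ᵇ 2 * k + 2)) ≡ 𝟙 (d ≡ᵇ k)
  go d s s≤1 with <-cmp d k
  ... | tri< d<k _ _ rewrite ≤ᵇ-false {2 * k} {2 * d + s} (below d s s≤1 d<k) | ≡ᵇ-false (<⇒≢ d<k) = refl
  ... | tri≈ _ refl _ rewrite ≤ᵇ-true (m≤m+n (2 * d) s) | ≤ᵇ-true {suc (2 * d + s)} {2 * d + 2} (within d s s≤1) | ≡ᵇ-refl d = refl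
  ... | tri> _ _ k<d rewrite ≤ᵇ-false {suc (2 * d + s)} {2 * k + 2} (above d s k<d) | ≡ᵇ-false (λ d≡k → <⇒≢ k<d (sym d≡k)) = 𝟙-∧-false _

headNeg-profile : ∀ w → headNeg w ≡ firstNegᴾ (profile w)
headNeg-profile []          = refl
headNeg-profile (a ∷ [])    = refl
headNeg-profile (a ∷ b ∷ w) = refl

descents-profile : ∀ w → descents w ≡ descentsᴾ (profile w)
descents-profile []          = refl
descents-profile (a ∷ [])    = refl
descents-profile (a ∷ b ∷ w) = trans (descents-cons₂ a b w) (cong (_+_ (𝟙 (a >ᵇ b))) (descents-profile (b ∷ w)))

lastNeg-profile : ∀ w → isNeg (lastLetter w) ≡ lastNegᴾ (profile w)
lastNeg-profile []              = refl
lastNeg-profile (a ∷ [])        = refl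
lastNeg-profile (a ∷ b ∷ [])    = refl
lastNeg-profile (a ∷ b ∷ c ∷ w) = lastNeg-profile (b ∷ c ∷ w)

lastLetter-bounded : ∀ m w → All (Bounded m) w → Bounded m (lastLetter w)
lastLetter-bounded m []          _          = z≤n
lastLetter-bounded m (a ∷ [])    (ba ∷ _)   = ba
lastLetter-bounded m (a ∷ b ∷ w) (_ ∷ bbw)  = lastLetter-bounded m (b ∷ w) bbw

desB-profile : ∀ w → desB w ≡ desBᴾ (profile w)
desB-profile []      = refl
desB-profile (a ∷ t) = begin
  desB (a ∷ t)                            ≡⟨ descents-cons₂ (+ 0) a t ⟩
  𝟙 ((+ 0) >ᵇ a) + descents (a ∷ t)         ≡⟨ cong₂ _+_ (cong 𝟙 (0>ᵇ a)) (descents-profile (a ∷ t)) ⟩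
  𝟙 (isNeg a) + descentsᴾ (profile (a ∷ t)) ≡⟨ cong (λ b → 𝟙 b + descentsᴾ (profile (a ∷ t))) (headNeg-profile (a ∷ t)) ⟩
  desBᴾ (profile (a ∷ t))                 ∎
  where
  open ≡-Reasoning
  0>ᵇ : ∀ a → ((+ 0) >ᵇ a) ≡ isNeg a
  0>ᵇ (+ zero)  = refl
  0>ᵇ +[1+ k ]  = refl
  0>ᵇ -[1+ k ]  = refl

rankOffset-< : ∀ m z → Bounded (suc m) z → rankOffset (suc m) z < suc m
rankOffset-< m (+ zero)  _         = s≤s z≤n
rankOffset-< m +[1+ k ]  (s≤s k≤m) = s≤s k≤m
rankOffset-< m -[1+ k ]  _         = s≤s (m∸n≤m m k)

window-*-scale : ∀ m a b p x → x < m →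
  𝟙 ((a * m ≤ᵇ p * m + x) ∧ (suc (p * m + x) ≤ᵇ b * m)) ≡ 𝟙 ((a ≤ᵇ p) ∧ (suc p ≤ᵇ b))
window-*-scale m a b p x x<m = cong₂ (λ u v → 𝟙 (u ∧ v)) (≤ᵇ-≡ lower⇒ ⇒lower) (≤ᵇ-≡ upper⇒ ⇒upper)
  where
  open ≤-Reasoning
  below-next : suc (p * m + x) ≤ suc p * m
  below-next = begin
    suc (p * m + x)  ≤⟨ +-monoʳ-< (p * m) x<m ⟩
    p * m + m        ≡⟨ +-comm (p * m) m ⟩
    suc p * m        ∎
  lower⇒ : a * m ≤ p * m + x → a ≤ p
  lower⇒ am≤ = ≮⇒≥ (λ p<a → <⇒≱ (<-≤-trans below-next (*-monoˡ-≤ m p<a)) am≤)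
  ⇒lower : a ≤ p → a * m ≤ p * m + x
  ⇒lower a≤p = ≤-trans (*-monoˡ-≤ m a≤p) (m≤m+n (p * m) x)
  upper⇒ : suc (p * m + x) ≤ b * m → suc p ≤ b
  upper⇒ ≤bm = ≮⇒≥ (λ b≤p → <⇒≱ ≤bm (≤-trans (*-monoˡ-≤ m (≤-pred b≤p)) (m≤m+n (p * m) x)))
  ⇒upper : suc p ≤ b → suc (p * m + x) ≤ b * m
  ⇒upper p<b = ≤-trans below-next (*-monoˡ-≤ m p<b)

endpointIn-slab : ∀ m a b c z → Bounded (suc m) z →
  ChainEncoding.endpointIn (suc m) (a * suc m) (b * suc m) c z ≡
  𝟙 ((a ≤ᵇ 2 * c + 𝟙 (not (isNeg z))) ∧ (suc (2 * c + 𝟙 (not (isNeg z))) ≤ᵇ b))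
endpointIn-slab m a b c z bz =
  trans (cong (λ u → 𝟙 ((a * suc m ≤ᵇ u) ∧ (suc u ≤ᵇ b * suc m))) (lemma (suc m) c (𝟙 (not (isNeg z))) (rankOffset (suc m) z)))
        (window-*-scale (suc m) a b (2 * c + 𝟙 (not (isNeg z))) (rankOffset (suc m) z) (rankOffset-< m z bz))
  where
  lemma : ∀ m c s o → 2 * m * c + (s * m + o) ≡ (2 * c + s) * m + o
  lemma = solve-∀

negStartChains-volumeWeight : ∀ m q w → All (Bounded (suc m)) w →
  𝟙 (headNeg w) * ChainEncoding.endpointIn (suc m) (q * suc m) (suc q * suc m) (descents w) (lastLetter w) ≡ volumeWeight q (profile w)
negStartChains-volumeWeight m q w bw = cong₂ _*_ (cong 𝟙 (headNeg-profile w))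
  (trans (endpointIn-slab m q (suc q) (descents w) (lastLetter w) (lastLetter-bounded (suc m) w bw))
         (cong₂ (λ d s → 𝟙 ((q ≤ᵇ 2 * d + 𝟙 (not s)) ∧ (suc (2 * d + 𝟙 (not s)) ≤ᵇ suc q))) (descents-profile w) (lastNeg-profile w)))

middleStartChains-desBSlabs : ∀ m k w → All (Bounded (suc m)) w →
  ChainEncoding.endpointIn (suc m) (2 * k * suc m) ((2 * k + 2) * suc m) (𝟙 (headNeg w) + descents w) (lastLetter w) ≡ desBSlabs k (profile w)
middleStartChains-desBSlabs m k w bw =
  trans (endpointIn-slab m (2 * k) (2 * k + 2) (𝟙 (headNeg w) + descents w) (lastLetter w) (lastLetter-bounded (suc m) w bw))
        (cong₃ (headNeg-profile w) (descents-profile w) (lastNeg-profile w))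
  where
  cong₃ : ∀ {h h′ d d′ s s′} → h ≡ h′ → d ≡ d′ → s ≡ s′ →
    𝟙 ((2 * k ≤ᵇ 2 * (𝟙 h + d) + 𝟙 (not s)) ∧ (suc (2 * (𝟙 h + d) + 𝟙 (not s)) ≤ᵇ 2 * k + 2)) ≡
    𝟙 ((2 * k ≤ᵇ 2 * (𝟙 h′ + d′) + 𝟙 (not s′)) ∧ (suc (2 * (𝟙 h′ + d′) + 𝟙 (not s′)) ≤ᵇ 2 * k + 2))
  cong₃ refl refl refl = refl

B≡∑𝔅-hasDesB : ∀ n k → B n k ≡ ∑𝔅 n (hasDesB k)
B≡∑𝔅-hasDesB n k = begin
  B n k                                                       ≡⟨ count-∑ (λ w → desB w ≡ᵇ k) (signedPerms n) ⟩
  ∑ (λ w → 𝟙 (desB w ≡ᵇ k)) (signedPerms n)                  ≡⟨ ∑-filter (λ w → 𝟙 (desB w ≡ᵇ k)) distinctAbs (signedWords n n) ⟩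
  ∑distinct n n (λ w → 𝟙 (desB w ≡ᵇ k))                      ≡⟨ ∑-cong (signedWords n n) (λ w → cong (λ d → 𝟙 (distinctAbs w) * 𝟙 (d ≡ᵇ k)) (desB-profile w)) ⟩
  ∑distinct n n (hasDesB k ∘ profile)                         ≡⟨ ∑𝔅-profile n (hasDesB k) ⟩
  ∑𝔅 n (hasDesB k)                                           ∎
  where open ≡-Reasoning

-- Words with a repeated absolute value

nonDistinctCount : ℕ → ℕ → ℕ
nonDistinctCount m n = ∑ (λ w → 𝟙 (not (distinctAbs w))) (signedWords m n)

∑distinct≤∑ : ∀ m n g → ∑distinct m n g ≤ ∑ g (signedWords m n)
∑distinct≤∑ m n g = ∑-mono (signedWords m n) (λ w →
  ≤-trans (m≤m+n (𝟙 (distinctAbs w) * g w) _) (≤-reflexive (𝟙-+-𝟙-not (distinctAbs w) (g w))))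

∑≤∑distinct+nonDistinct : ∀ m n g → (∀ w → g w ≤ 1) → ∑ g (signedWords m n) ≤ ∑distinct m n g + nonDistinctCount m n
∑≤∑distinct+nonDistinct m n g g≤1 = begin
  ∑ g W                                                         ≡⟨ ∑-cong W (λ w → 𝟙-+-𝟙-not (distinctAbs w) (g w)) ⟨
  ∑ (λ w → 𝟙 (distinctAbs w) * g w + 𝟙 (not (distinctAbs w)) * g w) W ≡⟨ ∑-+ _ _ W ⟩
  ∑distinct m n g + ∑ (λ w → 𝟙 (not (distinctAbs w)) * g w) W   ≤⟨ +-monoʳ-≤ (∑distinct m n g) (∑-mono W (λ w →
                                                                     ≤-trans (*-monoʳ-≤ (𝟙 (not (distinctAbs w))) (g≤1 w)) (≤-reflexive (*-identityʳ _)))) ⟩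
  ∑distinct m n g + nonDistinctCount m n                        ∎
  where
  open ≤-Reasoning
  W = signedWords m n

𝟙-any : ∀ {A : Set} (p : A → Bool) t → 𝟙 (any p t) ≤ ∑ (𝟙 ∘ p) t
𝟙-any p []      = z≤n
𝟙-any p (y ∷ t) = ≤-trans (𝟙-∨ (p y) _) (+-monoʳ-≤ (𝟙 (p y)) (𝟙-any p t))

hits : ℕ → ℕ → ℕ → ℕ
hits n s c = ∑< n (λ i → 𝟙 (s + i ≡ᵇ c))

hits-below : ∀ n s c → c < s → hits n s c ≡ 0
hits-below n s c c<s = trans (∑<-cong n (λ i _ → cong 𝟙 (≡ᵇ-false (λ e → <⇒≢ (≤-trans c<s (m≤m+n s i)) (sym e))))) (∑<-zero n)

hits-suc : ∀ n s c → hits (suc n) s c ≡ 𝟙 (s ≡ᵇ c) + hits n (suc s) c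
hits-suc n s c = cong₂ _+_ (cong (λ x → 𝟙 (x ≡ᵇ c)) (+-identityʳ s)) (∑<-cong n (λ i _ → cong (λ x → 𝟙 (x ≡ᵇ c)) (+-suc s i)))

hits≤1 : ∀ n s c → hits n s c ≤ 1
hits≤1 zero    s c = z≤n
hits≤1 (suc n) s c with s ≟ c
... | yes refl = ≤-reflexive (trans (hits-suc n s s) (cong₂ _+_ (cong 𝟙 (≡ᵇ-refl s)) (hits-below n (suc s) s ≤-refl)))
... | no s≢c   = ≤-trans (≤-reflexive (trans (hits-suc n s c) (cong (λ b → 𝟙 b + hits n (suc s) c) (≡ᵇ-false s≢c))))
                         (hits≤1 n (suc s) c)

∑-signedValues-absHits≤2 : ∀ m c → ∑ (λ a → 𝟙 (ℤ.∣ a ∣ ≡ᵇ c)) (signedValues m) ≤ 2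
∑-signedValues-absHits≤2 m c = ≤-trans (≤-reflexive (∑-signedValues m (λ a → 𝟙 (ℤ.∣ a ∣ ≡ᵇ c)))) (+-mono-≤ (hits≤1 m 1 c) (hits≤1 m 1 c))

∑-signedValues-occursAbs : ∀ m t → ∑ (λ a → 𝟙 (occursAbs a t)) (signedValues m) ≤ 2 * length t
∑-signedValues-occursAbs m t = begin
  ∑ (λ a → 𝟙 (occursAbs a t)) (signedValues m)                              ≤⟨ ∑-mono (signedValues m) (λ a → 𝟙-any _ t) ⟩
  ∑ (λ a → ∑ (λ y → 𝟙 (ℤ.∣ a ∣ ≡ᵇ ℤ.∣ y ∣)) t) (signedValues m)               ≡⟨ ∑-swap (λ a y → 𝟙 (ℤ.∣ a ∣ ≡ᵇ ℤ.∣ y ∣)) (signedValues m) t ⟩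
  ∑ (λ y → ∑ (λ a → 𝟙 (ℤ.∣ a ∣ ≡ᵇ ℤ.∣ y ∣)) (signedValues m)) t               ≤⟨ ∑-mono t (λ y → ∑-signedValues-absHits≤2 m ℤ.∣ y ∣) ⟩
  ∑ (λ _ → 2) t                                                            ≡⟨ ∑-const 2 t ⟩
  2 * length t                                                             ∎
  where open ≤-Reasoning

nonDistinctCount-suc : ∀ m n → nonDistinctCount m (suc n) ≤ 2 * m * nonDistinctCount m n + 2 * (n * (2 * m) ^ n)
nonDistinctCount-suc m n = begin
  nonDistinctCount m (suc n)
    ≡⟨ ∑-words-suc (λ w → 𝟙 (not (distinctAbs w))) (signedValues m) n ⟩
  ∑ (λ t → ∑ (λ a → 𝟙 (not (fresh a t ∧ distinctAbs t))) (signedValues m)) W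
    ≤⟨ ∑-mono W (λ t → ∑-mono (signedValues m) (λ a → repeat-cons (occursAbs a t) (distinctAbs t))) ⟩
  ∑ (λ t → ∑ (λ a → 𝟙 (not (distinctAbs t)) + 𝟙 (occursAbs a t)) (signedValues m)) W
    ≡⟨ ∑-cong W (λ t → trans (∑-+ _ _ (signedValues m))
                             (cong (_+ ∑ (λ a → 𝟙 (occursAbs a t)) (signedValues m))
                                   (trans (∑-const _ (signedValues m)) (trans (cong (𝟙 (not (distinctAbs t)) *_) (length-signedValues m))
                                                                              (*-comm _ (2 * m)))))) ⟩
  ∑ (λ t → 2 * m * 𝟙 (not (distinctAbs t)) + ∑ (λ a → 𝟙 (occursAbs a t)) (signedValues m)) W
    ≤⟨ ∑-mono W (λ t → +-monoʳ-≤ (2 * m * 𝟙 (not (distinctAbs t))) (∑-signedValues-occursAbs m t)) ⟩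
  ∑ (λ t → 2 * m * 𝟙 (not (distinctAbs t)) + 2 * length t) W
    ≡⟨ ∑-+ _ _ W ⟩
  ∑ (λ t → 2 * m * 𝟙 (not (distinctAbs t))) W + ∑ (λ t → 2 * length t) W
    ≡⟨ cong₂ _+_ (∑-*ˡ (2 * m) _ W) (trans (∑-*ˡ 2 length W) (cong (2 *_) (∑-length-words (signedValues m) n))) ⟩
  2 * m * nonDistinctCount m n + 2 * (n * length (signedValues m) ^ n)
    ≡⟨ cong (λ ℓ → 2 * m * nonDistinctCount m n + 2 * (n * ℓ ^ n)) (length-signedValues m) ⟩
  2 * m * nonDistinctCount m n + 2 * (n * (2 * m) ^ n) ∎
  where
  open ≤-Reasoning
  W = signedWords m n
  repeat-cons : ∀ o d → 𝟙 (not (not o ∧ d)) ≤ 𝟙 (not d) + 𝟙 o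
  repeat-cons true  d     = m≤n+m 1 (𝟙 (not d))
  repeat-cons false true  = z≤n
  repeat-cons false false = s≤s z≤n

nonDistinctCount≤ : ∀ m n → nonDistinctCount m (suc n) ≤ suc n * suc n * (2 * m) ^ n
nonDistinctCount≤ m zero    = ≤-trans (nonDistinctCount-suc m 0) (≤-trans (≤-reflexive (trans (+-identityʳ (2 * m * 0)) (*-zeroʳ (2 * m)))) z≤n)
nonDistinctCount≤ m (suc n) = begin
  nonDistinctCount m (suc (suc n))                                         ≤⟨ nonDistinctCount-suc m (suc n) ⟩
  2 * m * nonDistinctCount m (suc n) + 2 * (suc n * (2 * m) ^ suc n)       ≤⟨ +-monoˡ-≤ _ (*-monoʳ-≤ (2 * m) (nonDistinctCount≤ m n)) ⟩
  2 * m * (suc n * suc n * (2 * m) ^ n) + 2 * (suc n * (2 * m) ^ suc n)    ≡⟨ lemma (2 * m) ((2 * m) ^ n) n ⟩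
  (suc n * suc n + 2 * suc n) * (2 * m) ^ suc n                            ≤⟨ *-monoˡ-≤ ((2 * m) ^ suc n) (n≤1+n (suc n * suc n + 2 * suc n)) ⟩
  suc (suc n * suc n + 2 * suc n) * (2 * m) ^ suc n                        ≡⟨ cong (_* (2 * m) ^ suc n) (lemma′ n) ⟩
  suc (suc n) * suc (suc n) * (2 * m) ^ suc n                              ∎
  where
  open ≤-Reasoning
  lemma : ∀ a X n → a * (suc n * suc n * X) + 2 * (suc n * (a * X)) ≡ (suc n * suc n + 2 * suc n) * (a * X)
  lemma = solve-∀
  lemma′ : ∀ n → suc (suc n * suc n + 2 * suc n) ≡ suc (suc n) * suc (suc n)
  lemma′ = solve-∀

-- Lattice points of Δ_{C_n,j} as closed chains

closedChains : ℕ → ℕ → ℕ → ℕ → ℕ → ℕ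
closedChains m lo hi zero    a = 𝟙 ((lo ≤ᵇ a) ∧ (a ≤ᵇ hi))
closedChains m lo hi (suc n) a = ∑< (suc (2 * m)) (λ i → closedChains m lo hi n (a + i))

closedChains-above : ∀ m lo hi n a → hi < a → closedChains m lo hi n a ≡ 0
closedChains-above m lo hi zero    a hi<a rewrite ≤ᵇ-false {a} {hi} hi<a = 𝟙-∧-false (lo ≤ᵇ a)
closedChains-above m lo hi (suc n) a hi<a =
  trans (∑<-cong (suc (2 * m)) (λ i _ → closedChains-above m lo hi n (a + i) (≤-trans hi<a (m≤m+n a i)))) (∑<-zero (suc (2 * m)))

∑<-interval : ∀ N a w (f : ℕ → ℕ) → (∀ b → N ≤ b → f b ≡ 0) →
  ∑< N (λ b → 𝟙 ((a ≤ᵇ b) ∧ (b ≤ᵇ a + w)) * f b) ≡ ∑< (suc w) (λ i → f (a + i))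
∑<-interval N a w f f≡0 = begin
  ∑< N g                                     ≡⟨ ∑<-vanishing-tail N (a + suc w) g (λ b N≤b → trans (cong (I b *_) (f≡0 b N≤b)) (*-zeroʳ (I b))) ⟨
  ∑< (N + (a + suc w)) g                     ≡⟨ cong (λ k → ∑< k g) (+-comm N (a + suc w)) ⟩
  ∑< (a + suc w + N) g                       ≡⟨ ∑<-vanishing-tail (a + suc w) N g above ⟩
  ∑< (a + suc w) g                           ≡⟨ ∑<-+-length a (suc w) g ⟩
  ∑< a g + ∑< (suc w) (λ i → g (a + i))     ≡⟨ cong₂ _+_ (trans (∑<-cong a below) (∑<-zero a)) (∑<-cong (suc w) inside) ⟩
  0 + ∑< (suc w) (λ i → f (a + i))           ∎
  where
  open ≡-Reasoning
  I g : ℕ → ℕ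
  I b = 𝟙 ((a ≤ᵇ b) ∧ (b ≤ᵇ a + w))
  g b = I b * f b
  above : ∀ b → a + suc w ≤ b → g b ≡ 0
  above b a+w<b rewrite ≤ᵇ-false {b} {a + w} (≤-trans (≤-reflexive (sym (+-suc a w))) a+w<b) = cong (_* f b) (𝟙-∧-false (a ≤ᵇ b))
  below : ∀ b → b < a → g b ≡ 0
  below b b<a rewrite ≤ᵇ-false {a} {b} b<a = refl
  inside : ∀ i → i < suc w → g (a + i) ≡ f (a + i)
  inside i i≤w rewrite ≤ᵇ-true (m≤m+n a i) | ≤ᵇ-true (+-monoʳ-≤ a (≤-pred i≤w)) = *-identityˡ _

module _ (m j N : ℕ) (jm≤N : j * m ≤ N) where

  private
    V : List ℕ
    V = upTo (suc N)

    chainFrom : ℕ → List ℕ → Bool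
    chainFrom a t = chainOK m (a ∷ t) ∧ lastOK m j (a ∷ t)

    vanishes : ∀ n b → suc N ≤ b → closedChains m ((j ∸ 1) * m) (j * m) n b ≡ 0
    vanishes n b N<b = closedChains-above m _ _ n b (≤-trans (s≤s jm≤N) N<b)

    chainCount : ∀ n a → ∑ (𝟙 ∘ chainFrom a) (words V n) ≡ closedChains m ((j ∸ 1) * m) (j * m) n a
    chainCount zero    a = +-identityʳ _
    chainCount (suc n) a = begin
      ∑ (𝟙 ∘ chainFrom a) (words V (suc n))
        ≡⟨ ∑-words-suc (𝟙 ∘ chainFrom a) V n ⟩
      ∑ (λ t → ∑ (λ b → 𝟙 (chainFrom a (b ∷ t))) V) (words V n)
        ≡⟨ ∑-cong (words V n) (λ t → ∑-cong V (λ b → step b t)) ⟩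
      ∑ (λ t → ∑ (λ b → I b * 𝟙 (chainFrom b t)) V) (words V n)
        ≡⟨ ∑-swap (λ t b → I b * 𝟙 (chainFrom b t)) (words V n) V ⟩
      ∑ (λ b → ∑ (λ t → I b * 𝟙 (chainFrom b t)) (words V n)) V
        ≡⟨ ∑-cong V (λ b → ∑-*ˡ (I b) (𝟙 ∘ chainFrom b) (words V n)) ⟩
      ∑ (λ b → I b * ∑ (𝟙 ∘ chainFrom b) (words V n)) V
        ≡⟨ ∑-upTo _ (suc N) ⟩
      ∑< (suc N) (λ b → I b * ∑ (𝟙 ∘ chainFrom b) (words V n))
        ≡⟨ ∑<-cong (suc N) (λ b _ → cong (I b *_) (chainCount n b)) ⟩
      ∑< (suc N) (λ b → I b * closedChains m ((j ∸ 1) * m) (j * m) n b)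
        ≡⟨ ∑<-interval (suc N) a (2 * m) _ (vanishes n) ⟩
      closedChains m ((j ∸ 1) * m) (j * m) (suc n) a ∎
      where
      open ≡-Reasoning
      I : ℕ → ℕ
      I b = 𝟙 ((a ≤ᵇ b) ∧ (b ≤ᵇ a + 2 * m))
      step : ∀ b t → 𝟙 (chainFrom a (b ∷ t)) ≡ I b * 𝟙 (chainFrom b t)
      step b t = regroup (a ≤ᵇ b) (b ≤ᵇ a + 2 * m) (chainOK m (b ∷ t)) (lastOK m j (b ∷ t))
        where
        regroup : ∀ x y c l → 𝟙 ((x ∧ (y ∧ c)) ∧ l) ≡ 𝟙 (x ∧ y) * 𝟙 (c ∧ l)
        regroup true  true  c l = sym (+-identityʳ _)
        regroup true  false c l = refl
        regroup false y     c l = refl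

  count-inΔ : ∀ n → count (inΔ m j) (words V (suc n)) ≡ ∑< (suc m) (closedChains m ((j ∸ 1) * m) (j * m) n)
  count-inΔ n = begin
    count (inΔ m j) (words V (suc n))
      ≡⟨ count-∑ (inΔ m j) (words V (suc n)) ⟩
    ∑ (𝟙 ∘ inΔ m j) (words V (suc n))
      ≡⟨ ∑-words-suc (𝟙 ∘ inΔ m j) V n ⟩
    ∑ (λ t → ∑ (λ a → 𝟙 (inΔ m j (a ∷ t))) V) (words V n)
      ≡⟨ ∑-cong (words V n) (λ t → ∑-cong V (λ a → 𝟙-∧ (a ≤ᵇ m) (chainFrom a t))) ⟩
    ∑ (λ t → ∑ (λ a → 𝟙 (a ≤ᵇ m) * 𝟙 (chainFrom a t)) V) (words V n)
      ≡⟨ ∑-swap (λ t a → 𝟙 (a ≤ᵇ m) * 𝟙 (chainFrom a t)) (words V n) V ⟩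
    ∑ (λ a → ∑ (λ t → 𝟙 (a ≤ᵇ m) * 𝟙 (chainFrom a t)) (words V n)) V
      ≡⟨ ∑-cong V (λ a → ∑-*ˡ (𝟙 (a ≤ᵇ m)) (𝟙 ∘ chainFrom a) (words V n)) ⟩
    ∑ (λ a → 𝟙 (a ≤ᵇ m) * ∑ (𝟙 ∘ chainFrom a) (words V n)) V
      ≡⟨ ∑-upTo _ (suc N) ⟩
    ∑< (suc N) (λ a → 𝟙 (a ≤ᵇ m) * ∑ (𝟙 ∘ chainFrom a) (words V n))
      ≡⟨ ∑<-cong (suc N) (λ a _ → cong (𝟙 (a ≤ᵇ m) *_) (chainCount n a)) ⟩
    ∑< (suc N) (λ a → 𝟙 (a ≤ᵇ m) * closedChains m ((j ∸ 1) * m) (j * m) n a)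
      ≡⟨ ∑<-interval (suc N) 0 m _ (vanishes n) ⟩
    ∑< (suc m) (closedChains m ((j ∸ 1) * m) (j * m) n) ∎
    where open ≡-Reasoning

gridCount≡closedChains : ∀ n′ q m → suc q ≤ 2 * suc n′ →
  gridCount (suc n′) (suc q) m ≡ ∑< (suc m) (closedChains m (q * m) (suc q * m) n′)
gridCount≡closedChains n′ q m q<2n = count-inΔ m (suc q) (2 * suc n′ * m) (*-monoˡ-≤ m q<2n) n′

halfOpenChains≤closedChains : ∀ m lo hi n a → halfOpenChains m lo hi n a ≤ closedChains m lo hi n a
halfOpenChains≤closedChains m lo hi zero a with a <? hi
... | yes a<hi rewrite ≤ᵇ-true {suc a} {hi} a<hi | ≤ᵇ-true {a} {hi} (<⇒≤ a<hi) = ≤-refl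
... | no a≮hi  rewrite ≤ᵇ-false {suc a} {hi} (s≤s (≮⇒≥ a≮hi)) | 𝟙-∧-false (lo ≤ᵇ a) = z≤n
halfOpenChains≤closedChains m lo hi (suc n) a =
  ≤-trans (∑<-mono (2 * m) (λ i _ → halfOpenChains≤closedChains m lo hi n (a + i)))
          (∑<-window (suc (2 * m)) (2 * m) 0 _ (n≤1+n _))

-- Shifting the point with i steps still to go by q·n − i·(2n − 1) turns closed steps in [0, 2m] into steps in [0, 2(m + n)),
-- and the end window [qm, (q+1)m] into a subset of [q(m + n), (q+1)(m + n)).
module _ (m q n′ : ℕ) where

  private
    n m′ d : ℕ
    n  = suc n′
    m′ = m + n
    d  = suc (2 * n′)

    shift : ℕ → ℕ
    shift zero    = q * n
    shift (suc i) = shift i ∸ d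

    shift≡ : ∀ i → shift i ≡ q * n ∸ i * d
    shift≡ zero    = refl
    shift≡ (suc i) = trans (cong (_∸ d) (shift≡ i)) (trans (∸-+-assoc (q * n) (i * d) d) (cong (q * n ∸_) (+-comm (i * d) d)))

    shift-end : q ≤ 2 * n′ → shift n′ ≤ n′
    shift-end q≤2n′ = ≤-trans (≤-reflexive (shift≡ n′)) (m≤n+o⇒m∸n≤o (q * n) (n′ * d) (≤-trans (*-monoˡ-≤ n q≤2n′) (≤-reflexive (lemma n′))))
      where
      lemma : ∀ n′ → 2 * n′ * suc n′ ≡ n′ * suc (2 * n′) + n′
      lemma = solve-∀

    lo≤ : ∀ a → q * m ≤ a → q * m′ ≤ a + q * n
    lo≤ a qm≤a = ≤-trans (≤-reflexive (*-distribˡ-+ q m n)) (+-monoˡ-≤ (q * n) qm≤a)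

    <hi : ∀ a → a ≤ suc q * m → suc (a + q * n) ≤ suc q * m′
    <hi a a≤ = ≤-trans (s≤s (+-monoˡ-≤ (q * n) a≤)) (≤-trans (s≤s (m≤m+n _ n′)) (≤-reflexive (lemma m q n′)))
      where
      lemma : ∀ m q n′ → suc (suc q * m + q * suc n′ + n′) ≡ suc q * (m + suc n′)
      lemma = solve-∀

    closed≤halfOpen : ∀ i a → closedChains m (q * m) (suc q * m) i a ≤ halfOpenChains m′ (q * m′) (suc q * m′) i (a + shift i)
    closed≤halfOpen zero a with q * m ≤? a | a ≤? suc q * m
    ... | yes qm≤a | yes a≤ rewrite ≤ᵇ-true qm≤a | ≤ᵇ-true a≤ | ≤ᵇ-true (lo≤ a qm≤a) | ≤ᵇ-true (<hi a a≤) = ≤-refl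
    ... | yes qm≤a | no a≰   rewrite ≤ᵇ-false {a} {suc q * m} (≰⇒> a≰) | 𝟙-∧-false (q * m ≤ᵇ a) = z≤n
    ... | no qm≰a  | _       rewrite ≤ᵇ-false {q * m} {a} (≰⇒> qm≰a) = z≤n
    closed≤halfOpen (suc i) a = begin
      ∑< (suc (2 * m)) (λ t → closedChains m (q * m) (suc q * m) i (a + t))
        ≤⟨ ∑<-mono (suc (2 * m)) (λ t _ → closed≤halfOpen i (a + t)) ⟩
      ∑< (suc (2 * m)) (λ t → H (a + t + shift i))
        ≡⟨ ∑<-cong (suc (2 * m)) (λ t _ → cong H (regroup t)) ⟩
      ∑< (suc (2 * m)) (λ t → H (a + shift (suc i) + (δ + t)))
        ≤⟨ ∑<-window (2 * m′) (suc (2 * m)) δ (λ u → H (a + shift (suc i) + u)) fits ⟩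
      ∑< (2 * m′) (λ u → H (a + shift (suc i) + u)) ∎
      where
      open ≤-Reasoning
      H : ℕ → ℕ
      H = halfOpenChains m′ (q * m′) (suc q * m′) i
      δ : ℕ
      δ = shift i ∸ shift (suc i)
      shift-step : shift (suc i) + δ ≡ shift i
      shift-step = m+[n∸m]≡n (m∸n≤m (shift i) d)
      δ≤d : δ ≤ d
      δ≤d = m≤n+o⇒m∸n≤o (shift i) (shift (suc i)) (≤-trans (m≤n+m∸n (shift i) d) (≤-reflexive (+-comm d (shift i ∸ d))))
      regroup : ∀ t → a + t + shift i ≡ a + shift (suc i) + (δ + t)
      regroup t = trans (cong (_+_ (a + t)) (sym shift-step)) (lemma a t (shift (suc i)) δ)
        where
        lemma : ∀ a t s δ → a + t + (s + δ) ≡ a + s + (δ + t)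
        lemma = solve-∀
      fits : δ + suc (2 * m) ≤ 2 * m′
      fits = ≤-trans (+-monoˡ-≤ (suc (2 * m)) δ≤d) (≤-reflexive (lemma m n′))
        where
        lemma : ∀ m n′ → suc (2 * n′) + suc (2 * m) ≡ 2 * (m + suc n′)
        lemma = solve-∀

  ∑closedChains≤∑halfOpenChains : q ≤ 2 * n′ →
    ∑< (suc m) (closedChains m (q * m) (suc q * m) n′) ≤ ∑< m′ (halfOpenChains m′ (q * m′) (suc q * m′) n′)
  ∑closedChains≤∑halfOpenChains q≤2n′ = begin
    ∑< (suc m) (closedChains m (q * m) (suc q * m) n′)         ≤⟨ ∑<-mono (suc m) (λ a _ → closed≤halfOpen n′ a) ⟩
    ∑< (suc m) (λ a → H (a + shift n′))                        ≡⟨ ∑<-cong (suc m) (λ a _ → cong H (+-comm a (shift n′))) ⟩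
    ∑< (suc m) (λ a → H (shift n′ + a))                        ≤⟨ ∑<-window m′ (suc m) (shift n′) H fits ⟩
    ∑< m′ H                                                    ∎
    where
    open ≤-Reasoning
    H : ℕ → ℕ
    H = halfOpenChains m′ (q * m′) (suc q * m′) n′
    fits : shift n′ + suc m ≤ m′
    fits = ≤-trans (≤-reflexive (+-suc (shift n′) m))
                   (≤-trans (s≤s (+-monoˡ-≤ m (shift-end q≤2n′))) (≤-reflexive (trans (cong suc (+-comm n′ m)) (sym (+-suc m n′)))))

^-distribʳ-* : ∀ a b k → (a * b) ^ k ≡ a ^ k * b ^ k
^-distribʳ-* a b zero    = refl
^-distribʳ-* a b (suc k) = trans (cong (a * b *_) (^-distribʳ-* a b k)) (lemma a b (a ^ k) (b ^ k))
  where
  lemma : ∀ a b x y → a * b * (x * y) ≡ a * x * (b * y)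
  lemma = solve-∀

+-^-≤ : ∀ k b c → (b + c) ^ suc k ≤ b ^ suc k + suc k * c * (b + c) ^ k
+-^-≤ zero    b c = ≤-reflexive (lemma b c)
  where
  lemma : ∀ b c → (b + c) * 1 ≡ b * 1 + 1 * c * 1
  lemma = solve-∀
+-^-≤ (suc k) b c = begin
  (b + c) * (b + c) ^ suc k                                        ≤⟨ *-monoʳ-≤ (b + c) (+-^-≤ k b c) ⟩
  (b + c) * (b ^ suc k + suc k * c * (b + c) ^ k)                  ≡⟨ lemma b c k (b ^ suc k) ((b + c) ^ k) ⟩
  b * b ^ suc k + c * b ^ suc k + suc k * c * (b + c) ^ suc k      ≤⟨ +-monoˡ-≤ _ (+-monoʳ-≤ (b * b ^ suc k)
                                                                       (*-monoʳ-≤ c (^-monoˡ-≤ (suc k) (m≤m+n b c)))) ⟩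
  b * b ^ suc k + c * (b + c) ^ suc k + suc k * c * (b + c) ^ suc k ≡⟨ lemma′ (b * b ^ suc k) c ((b + c) ^ suc k) k ⟩
  b * b ^ suc k + suc (suc k) * c * (b + c) ^ suc k                ∎
  where
  open ≤-Reasoning
  lemma : ∀ b c k P Q → (b + c) * (P + suc k * c * Q) ≡ b * P + c * P + suc k * c * ((b + c) * Q)
  lemma = solve-∀
  lemma′ : ∀ X c Y k → X + c * Y + suc k * c * Y ≡ X + suc (suc k) * c * Y
  lemma′ = solve-∀

fallingFactorial : ℕ → ℕ → ℕ
fallingFactorial m       zero    = 1
fallingFactorial zero    (suc n) = 0
fallingFactorial (suc m) (suc n) = suc m * fallingFactorial m n

binomial-1 : ∀ m → binomial m 1 ≡ m
binomial-1 zero    = refl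
binomial-1 (suc m) = trans (cong (_+ 1) (binomial-1 m)) (+-comm m 1)

binomial-absorption : ∀ m n → binomial (suc m) (suc n) * suc n ≡ suc m * binomial m n
binomial-absorption zero    zero    = refl
binomial-absorption zero    (suc n) = refl
binomial-absorption (suc m) zero    = trans (cong (λ x → (x + 1 + 1) * 1) (binomial-1 m)) (lemma m)
  where
  lemma : ∀ m → (m + 1 + 1) * 1 ≡ suc (suc m) * 1
  lemma = solve-∀
binomial-absorption (suc m) (suc n) = begin
  (binomial (suc m) (suc (suc n)) + binomial (suc m) (suc n)) * suc (suc n)
    ≡⟨ lemma (binomial (suc m) (suc (suc n))) (binomial (suc m) (suc n)) n ⟩
  binomial (suc m) (suc (suc n)) * suc (suc n) + binomial (suc m) (suc n) * suc n + binomial (suc m) (suc n)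
    ≡⟨ cong₂ (λ x y → x + y + binomial (suc m) (suc n)) (binomial-absorption m (suc n)) (binomial-absorption m n) ⟩
  suc m * binomial m (suc n) + suc m * binomial m n + binomial (suc m) (suc n)
    ≡⟨ lemma′ (suc m) (binomial m (suc n)) (binomial m n) ⟩
  suc (suc m) * (binomial m (suc n) + binomial m n) ∎
  where
  open ≡-Reasoning
  lemma : ∀ x y n → (x + y) * suc (suc n) ≡ x * suc (suc n) + y * suc n + y
  lemma = solve-∀
  lemma′ : ∀ a x y → a * x + a * y + (x + y) ≡ suc a * (x + y)
  lemma′ = solve-∀

!*binomial≡fallingFactorial : ∀ n m → n ! * binomial m n ≡ fallingFactorial m n
!*binomial≡fallingFactorial zero    m       = refl
!*binomial≡fallingFactorial (suc n) zero    = *-zeroʳ (suc n !)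
!*binomial≡fallingFactorial (suc n) (suc m) = begin
  suc n * n ! * binomial (suc m) (suc n)    ≡⟨ lemma (suc n) (n !) (binomial (suc m) (suc n)) ⟩
  n ! * (binomial (suc m) (suc n) * suc n)  ≡⟨ cong (n ! *_) (binomial-absorption m n) ⟩
  n ! * (suc m * binomial m n)              ≡⟨ x*[y*z]≡y*[x*z] (n !) (suc m) (binomial m n) ⟩
  suc m * (n ! * binomial m n)              ≡⟨ cong (suc m *_) (!*binomial≡fallingFactorial n m) ⟩
  suc m * fallingFactorial m n              ∎
  where
  open ≡-Reasoning
  lemma : ∀ a b c → a * b * c ≡ b * (c * a)
  lemma = solve-∀
  x*[y*z]≡y*[x*z] : ∀ a b c → a * (b * c) ≡ b * (a * c)
  x*[y*z]≡y*[x*z] = solve-∀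

fallingFactorial≤^ : ∀ m n → fallingFactorial m n ≤ m ^ n
fallingFactorial≤^ m       zero    = ≤-refl
fallingFactorial≤^ zero    (suc n) = z≤n
fallingFactorial≤^ (suc m) (suc n) = *-monoʳ-≤ (suc m) (≤-trans (fallingFactorial≤^ m n) (^-monoˡ-≤ n (n≤1+n m)))

∸^≤fallingFactorial : ∀ m n → (m ∸ n) ^ n ≤ fallingFactorial m n
∸^≤fallingFactorial m       zero    = ≤-refl
∸^≤fallingFactorial zero    (suc n) = z≤n
∸^≤fallingFactorial (suc m) (suc n) = *-mono-≤ (≤-trans (m∸n≤m m n) (n≤1+n m)) (∸^≤fallingFactorial m n)

ℕ→ℚ : ℕ → ℚ
ℕ→ℚ n = + n ℚ./ 1

toℚᵘ-ℕ→ℚ : ∀ n → toℚᵘ (ℕ→ℚ n) ℚᵘ.≃ ℚᵘ.mkℚᵘ (+ n) 0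
toℚᵘ-ℕ→ℚ n = ℚP.toℚᵘ-fromℚᵘ (ℚᵘ.mkℚᵘ (+ n) 0)

ℕ→ℚ-+ : ∀ a b → ℕ→ℚ (a + b) ≡ ℕ→ℚ a ℚ.+ ℕ→ℚ b
ℕ→ℚ-+ a b = ℚP.toℚᵘ-injective (begin
  toℚᵘ (ℕ→ℚ (a + b))                                ≈⟨ toℚᵘ-ℕ→ℚ (a + b) ⟩
  ℚᵘ.mkℚᵘ (+ (a + b)) 0                             ≈⟨ ℚᵘ.*≡* (cong (ℤ._* + 1) (trans (ℤ.pos-+ a b) (lemma (+ a) (+ b)))) ⟩
  ℚᵘ.mkℚᵘ (+ a) 0 ℚᵘ.+ ℚᵘ.mkℚᵘ (+ b) 0              ≈⟨ ℚᵘP.+-cong (toℚᵘ-ℕ→ℚ a) (toℚᵘ-ℕ→ℚ b) ⟨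
  toℚᵘ (ℕ→ℚ a) ℚᵘ.+ toℚᵘ (ℕ→ℚ b)                    ≈⟨ ℚP.toℚᵘ-homo-+ (ℕ→ℚ a) (ℕ→ℚ b) ⟨
  toℚᵘ (ℕ→ℚ a ℚ.+ ℕ→ℚ b)                            ∎)
  where
  open ℚᵘP.≃-Reasoning
  lemma : ∀ x y → x ℤ.+ y ≡ x ℤ.* + 1 ℤ.+ y ℤ.* + 1
  lemma = ℤ-Solver.solve-∀

ℕ→ℚ-* : ∀ a b → ℕ→ℚ (a * b) ≡ ℕ→ℚ a ℚ.* ℕ→ℚ b
ℕ→ℚ-* a b = ℚP.toℚᵘ-injective (begin
  toℚᵘ (ℕ→ℚ (a * b))                                ≈⟨ toℚᵘ-ℕ→ℚ (a * b) ⟩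
  ℚᵘ.mkℚᵘ (+ (a * b)) 0                             ≈⟨ ℚᵘ.*≡* (cong (ℤ._* + 1) (ℤ.pos-* a b)) ⟩
  ℚᵘ.mkℚᵘ (+ a) 0 ℚᵘ.* ℚᵘ.mkℚᵘ (+ b) 0              ≈⟨ ℚᵘP.*-cong (toℚᵘ-ℕ→ℚ a) (toℚᵘ-ℕ→ℚ b) ⟨
  toℚᵘ (ℕ→ℚ a) ℚᵘ.* toℚᵘ (ℕ→ℚ b)                    ≈⟨ ℚP.toℚᵘ-homo-* (ℕ→ℚ a) (ℕ→ℚ b) ⟨
  toℚᵘ (ℕ→ℚ a ℚ.* ℕ→ℚ b)                            ∎)
  where open ℚᵘP.≃-Reasoning

∣⊖∣≤ : ∀ a c e → a ≤ c + e → c ≤ a + e → ℤ.∣ a ⊖ c ∣ ≤ e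
∣⊖∣≤ a c e a≤c+e c≤a+e with ≤-total c a
... | inj₁ c≤a rewrite ℤ.⊖-≥ c≤a = m≤n+o⇒m∸n≤o a c a≤c+e
... | inj₂ a≤c rewrite ℤ.∣m⊖n∣≡∣n⊖m∣ a c | ℤ.⊖-≥ a≤c = m≤n+o⇒m∸n≤o c a c≤a+e

∣/−ℕ→ℚ∣< : ∀ A b v e .{{_ : NonZero b}} (ε : ℚ) → 0ℚ ℚ.< ε →
  A ≤ v * b + e → v * b ≤ A + e → e * ℚ.↧ₙ ε < b → ℚ.∣ (+ A ℚ./ b) ℚ.- ℕ→ℚ v ∣ ℚ.< ε
∣/−ℕ→ℚ∣< A (suc b′) v e ε@(mkℚ +[1+ p ] d _) _ A≤ ≤A e*d<b =
  ℚP.toℚᵘ-cancel-< (ℚᵘP.<-respˡ-≃ (ℚᵘP.≃-sym toℚᵘ-∣x−y∣) ∣X−Y∣<ε)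
  where
  b = suc b′
  X Y : ℚᵘ.ℚᵘ
  X = ℚᵘ.mkℚᵘ (+ A) b′
  Y = ℚᵘ.mkℚᵘ (+ v) 0
  toℚᵘ-∣x−y∣ : toℚᵘ (ℚ.∣ (+ A ℚ./ b) ℚ.- ℕ→ℚ v ∣) ℚᵘ.≃ ℚᵘ.∣ X ℚᵘ.+ ℚᵘ.- Y ∣
  toℚᵘ-∣x−y∣ = ℚᵘP.≃-trans (ℚP.toℚᵘ-homo-∣-∣ (x ℚ.- y)) (ℚᵘP.∣-∣-cong (ℚᵘP.≃-trans (ℚP.toℚᵘ-homo-+ x (ℚ.- y))
                 (ℚᵘP.+-cong (ℚP.toℚᵘ-fromℚᵘ X) (ℚᵘP.≃-trans (ℚP.toℚᵘ-homo‿- y) (ℚᵘP.-‿cong (toℚᵘ-ℕ→ℚ v))))))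
    where
    x = + A ℚ./ b
    y = ℕ→ℚ v
  N : ℤ
  N = + A ℤ.* + 1 ℤ.+ ℤ.- (+ v) ℤ.* + b
  N≡ : N ≡ A ⊖ v * b
  N≡ = begin
    + A ℤ.* + 1 ℤ.+ ℤ.- (+ v) ℤ.* + b   ≡⟨ cong₂ ℤ._+_ (ℤ.*-identityʳ (+ A)) (sym (ℤ.neg-distribˡ-* (+ v) (+ b))) ⟩
    + A ℤ.+ ℤ.- (+ v ℤ.* + b)            ≡⟨ cong (λ z → + A ℤ.+ ℤ.- z) (ℤ.pos-* v b) ⟨
    + A ℤ.+ ℤ.- (+ (v * b))              ≡⟨ ℤ.m-n≡m⊖n A (v * b) ⟩
    A ⊖ v * b                            ∎
    where open ≡-Reasoning
  ∣N∣≤e : ℤ.∣ N ∣ ≤ e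
  ∣N∣≤e rewrite N≡ = ∣⊖∣≤ A (v * b) e A≤ ≤A
  ∣N∣*d<p*b : ℤ.∣ N ∣ * suc d < suc p * (b * 1)
  ∣N∣*d<p*b = begin-strict
    ℤ.∣ N ∣ * suc d   ≤⟨ *-monoˡ-≤ (suc d) ∣N∣≤e ⟩
    e * suc d         <⟨ e*d<b ⟩
    b                 ≤⟨ m≤n*m b (suc p) ⟩
    suc p * b         ≡⟨ cong (suc p *_) (*-identityʳ b) ⟨
    suc p * (b * 1)   ∎
    where open ≤-Reasoning
  ∣X−Y∣<ε : ℚᵘ.∣ X ℚᵘ.+ ℚᵘ.- Y ∣ ℚᵘ.< toℚᵘ ε
  ∣X−Y∣<ε = ℚᵘ.*<* (subst₂ ℤ._<_ (ℤ.pos-* ℤ.∣ N ∣ (suc d)) (ℤ.pos-* (suc p) (b * 1)) (ℤ.+<+ ∣N∣*d<p*b))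
∣/−ℕ→ℚ∣< A (suc b′) v e (mkℚ (+ zero) d c) (ℚ.*<* (ℤ.+<+ ())) _ _ _
∣/−ℕ→ℚ∣< A (suc b′) v e (mkℚ -[1+ _ ] _ _) (ℚ.*<* ())          _ _ _

-- Volumes of the slabs Δ_{C_n,j}

vol : ℕ → ℕ → ℕ
vol n q = ∑𝔅 n (volumeWeight q)

halfOpenChains-below : ∀ m lo hi k a → suc (a + k * (2 * m)) ≤ lo + k → halfOpenChains m lo hi k a ≡ 0
halfOpenChains-below m lo hi zero    a a<lo rewrite ≤ᵇ-false {lo} {a} (subst₂ _≤_ (cong suc (+-identityʳ a)) (+-identityʳ lo) a<lo) = refl
halfOpenChains-below m lo hi (suc k) a below = trans (∑<-cong (2 * m) (λ i i<2m → halfOpenChains-below m lo hi k (a + i) (step i i<2m)))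
                                                     (∑<-zero (2 * m))
  where
  step : ∀ i → i < 2 * m → suc (a + i + k * (2 * m)) ≤ lo + k
  step i i<2m = +-cancelˡ-≤ 1 _ _ (begin
    suc (suc (a + i + k * (2 * m)))   ≡⟨ lemma a i k (2 * m) ⟩
    suc (a + (suc i + k * (2 * m)))   ≤⟨ s≤s (+-monoʳ-≤ a (+-monoˡ-≤ (k * (2 * m)) i<2m)) ⟩
    suc (a + (2 * m + k * (2 * m)))   ≤⟨ below ⟩
    lo + suc k                        ≡⟨ +-suc lo k ⟩
    suc (lo + k)                      ∎)
    where
    open ≤-Reasoning
    lemma : ∀ a i k M → suc (suc (a + i + k * M)) ≡ suc (a + (suc i + k * M))
    lemma = solve-∀

module Volumes (n′ : ℕ) where

  n : ℕ
  n = suc n′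

  halfOpenCount : ℕ → ℕ → ℕ
  halfOpenCount m q = ∑< m (halfOpenChains m (q * m) (suc q * m) n′)

  halfOpenCount≡∑volumeWeight : ∀ m q → halfOpenCount (suc m) q ≡ ∑ (volumeWeight q ∘ profile) (signedWords (suc m) n)
  halfOpenCount≡∑volumeWeight m q = trans (ChainEncoding.halfOpenChains-fromNegatives (suc m) (q * suc m) (suc q * suc m) n′)
                                          (∑-signedWords-congᴮ (suc m) n (negStartChains-volumeWeight m q))

  halfOpenCount-lower : ∀ m q → binomial (suc m) n * vol n q ≤ halfOpenCount (suc m) q
  halfOpenCount-lower m q = begin
    binomial (suc m) n * vol n q                          ≡⟨ ∑distinct-profile n (volumeWeight q) (suc m) ⟨
    ∑distinct (suc m) n (volumeWeight q ∘ profile)        ≤⟨ ∑distinct≤∑ (suc m) n (volumeWeight q ∘ profile) ⟩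
    ∑ (volumeWeight q ∘ profile) (signedWords (suc m) n)  ≡⟨ halfOpenCount≡∑volumeWeight m q ⟨
    halfOpenCount (suc m) q                               ∎
    where open ≤-Reasoning

  halfOpenCount-upper : ∀ m q → halfOpenCount (suc m) q ≤ binomial (suc m) n * vol n q + nonDistinctCount (suc m) n
  halfOpenCount-upper m q = begin
    halfOpenCount (suc m) q                                                   ≡⟨ halfOpenCount≡∑volumeWeight m q ⟩
    ∑ (volumeWeight q ∘ profile) (signedWords (suc m) n)                      ≤⟨ ∑≤∑distinct+nonDistinct (suc m) n _ (λ w → volumeWeight≤1 q (profile w)) ⟩
    ∑distinct (suc m) n (volumeWeight q ∘ profile) + nonDistinctCount (suc m) n ≡⟨ cong (_+ nonDistinctCount (suc m) n) (∑distinct-profile n (volumeWeight q) (suc m)) ⟩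
    binomial (suc m) n * vol n q + nonDistinctCount (suc m) n                 ∎
    where open ≤-Reasoning

  q≤2n′⇒q<2n : ∀ {q} → q ≤ 2 * n′ → suc q ≤ 2 * n
  q≤2n′⇒q<2n q≤2n′ = ≤-trans (s≤s q≤2n′) (≤-trans (n≤1+n _) (≤-reflexive (lemma n′)))
    where
    lemma : ∀ n′ → suc (suc (2 * n′)) ≡ 2 * suc n′
    lemma = solve-∀

  halfOpenCount≤gridCount : ∀ m q → q ≤ 2 * n′ → halfOpenCount m q ≤ gridCount n (suc q) m
  halfOpenCount≤gridCount m q q≤2n′ = begin
    halfOpenCount m q                                          ≤⟨ ∑<-mono m (λ a _ → halfOpenChains≤closedChains m (q * m) (suc q * m) n′ a) ⟩
    ∑< m (closedChains m (q * m) (suc q * m) n′)               ≤⟨ ∑<-window (suc m) m 0 _ (n≤1+n m) ⟩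
    ∑< (suc m) (closedChains m (q * m) (suc q * m) n′)         ≡⟨ gridCount≡closedChains n′ q m (q≤2n′⇒q<2n q≤2n′) ⟨
    gridCount n (suc q) m                                      ∎
    where open ≤-Reasoning

  gridCount≤halfOpenCount : ∀ m q → q ≤ 2 * n′ → gridCount n (suc q) m ≤ halfOpenCount (m + n) q
  gridCount≤halfOpenCount m q q≤2n′ = ≤-trans (≤-reflexive (gridCount≡closedChains n′ q m (q≤2n′⇒q<2n q≤2n′)))
                                              (∑closedChains≤∑halfOpenChains m q n′ q≤2n′)

  errorConst : ℕ → ℕ
  errorConst q = vol n q * (n * n * 2 ^ n′) + n ! * (n * n * 4 ^ n′)

  gridCount-lower : ∀ m q → q ≤ 2 * n′ → n ≤ suc m →
    vol n q * suc m ^ n ≤ n ! * gridCount n (suc q) (suc m) + vol n q * (n * n * suc m ^ n′)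
  gridCount-lower m₀ q q≤2n′ n≤m = begin
    v * m ^ n                                          ≡⟨ cong (λ x → v * x ^ n) (m∸n+n≡m n≤m) ⟨
    v * ((m ∸ n) + n) ^ n                              ≤⟨ *-monoʳ-≤ v (+-^-≤ n′ (m ∸ n) n) ⟩
    v * ((m ∸ n) ^ n + n * n * ((m ∸ n) + n) ^ n′)     ≡⟨ cong (λ x → v * ((m ∸ n) ^ n + n * n * x ^ n′)) (m∸n+n≡m n≤m) ⟩
    v * ((m ∸ n) ^ n + n * n * m ^ n′)                 ≡⟨ *-distribˡ-+ v _ _ ⟩
    v * (m ∸ n) ^ n + v * (n * n * m ^ n′)             ≤⟨ +-monoˡ-≤ _ (*-monoʳ-≤ v (∸^≤fallingFactorial m n)) ⟩
    v * fallingFactorial m n + v * (n * n * m ^ n′)    ≡⟨ cong (λ x → v * x + v * (n * n * m ^ n′)) (!*binomial≡fallingFactorial n m) ⟨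
    v * (n ! * binomial m n) + v * (n * n * m ^ n′)    ≡⟨ cong (_+ v * (n * n * m ^ n′)) (lemma v (n !) (binomial m n)) ⟩
    n ! * (binomial m n * v) + v * (n * n * m ^ n′)    ≤⟨ +-monoˡ-≤ _ (*-monoʳ-≤ (n !) (≤-trans (halfOpenCount-lower m₀ q)
                                                                                              (halfOpenCount≤gridCount m q q≤2n′))) ⟩
    n ! * gridCount n (suc q) m + v * (n * n * m ^ n′) ∎
    where
    open ≤-Reasoning
    m = suc m₀
    v = vol n q
    lemma : ∀ a b c → a * (b * c) ≡ b * (c * a)
    lemma = solve-∀

  gridCount-upper : ∀ m q → q ≤ 2 * n′ → n ≤ suc m →
    n ! * gridCount n (suc q) (suc m) ≤ vol n q * suc m ^ n + errorConst q * suc m ^ n′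
  gridCount-upper m₀ q q≤2n′ n≤m = begin
    n ! * gridCount n (suc q) m                                ≤⟨ *-monoʳ-≤ (n !) (gridCount≤halfOpenCount m q q≤2n′) ⟩
    n ! * halfOpenCount (m + n) q                              ≤⟨ *-monoʳ-≤ (n !) (halfOpenCount-upper (m₀ + n) q) ⟩
    n ! * (binomial (m + n) n * v + nonDistinctCount (m + n) n) ≡⟨ lemma (n !) (binomial (m + n) n) v _ ⟩
    n ! * binomial (m + n) n * v + n ! * nonDistinctCount (m + n) n
                                                               ≡⟨ cong (λ x → x * v + n ! * nonDistinctCount (m + n) n) (!*binomial≡fallingFactorial n (m + n)) ⟩
    fallingFactorial (m + n) n * v + n ! * nonDistinctCount (m + n) n
                                                               ≤⟨ +-mono-≤ (*-monoˡ-≤ v (fallingFactorial≤^ (m + n) n)) (*-monoʳ-≤ (n !) (nonDistinctCount≤ (m + n) n′)) ⟩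
    (m + n) ^ n * v + n ! * (n * n * (2 * (m + n)) ^ n′)       ≤⟨ +-mono-≤ (*-monoˡ-≤ v (+-^-≤ n′ m n)) (*-monoʳ-≤ (n !) (*-monoʳ-≤ (n * n) (^-monoˡ-≤ n′ 2[m+n]≤4m))) ⟩
    (m ^ n + n * n * (m + n) ^ n′) * v + n ! * (n * n * (4 * m) ^ n′)
                                                               ≤⟨ +-monoˡ-≤ _ (*-monoˡ-≤ v (+-monoʳ-≤ (m ^ n) (*-monoʳ-≤ (n * n) (^-monoˡ-≤ n′ m+n≤2m)))) ⟩
    (m ^ n + n * n * (2 * m) ^ n′) * v + n ! * (n * n * (4 * m) ^ n′)
                                                               ≡⟨ cong₂ (λ x y → (m ^ n + n * n * x) * v + n ! * (n * n * y)) (^-distribʳ-* 2 m n′) (^-distribʳ-* 4 m n′) ⟩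
    (m ^ n + n * n * (2 ^ n′ * m ^ n′)) * v + n ! * (n * n * (4 ^ n′ * m ^ n′))
                                                               ≡⟨ lemma′ (m ^ n) (n * n) (2 ^ n′) (4 ^ n′) (m ^ n′) v (n !) ⟩
    v * m ^ n + errorConst q * m ^ n′                          ∎
    where
    open ≤-Reasoning
    m = suc m₀
    v = vol n q
    m+n≤2m : m + n ≤ 2 * m
    m+n≤2m = ≤-trans (+-monoʳ-≤ m n≤m) (≤-reflexive (cong (_+_ m) (sym (+-identityʳ m))))
    2[m+n]≤4m : 2 * (m + n) ≤ 4 * m
    2[m+n]≤4m = ≤-trans (*-monoʳ-≤ 2 m+n≤2m) (≤-reflexive (sym (*-assoc 2 2 m)))
    lemma : ∀ F b v N → F * (b * v + N) ≡ F * b * v + F * N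
    lemma = solve-∀
    lemma′ : ∀ P nn t f Q V F → (P + nn * (t * Q)) * V + F * (nn * (f * Q)) ≡ V * P + (V * (nn * t) + F * (nn * f)) * Q
    lemma′ = solve-∀

  vol-HasNormVol : ∀ q → q ≤ 2 * n′ → HasNormVol n (suc q) (ℕ→ℚ (vol n q))
  vol-HasNormVol q q≤2n′ ε 0<ε = M , λ m M≤m →
    ∣/−ℕ→ℚ∣< (n ! * gridCount n (suc q) (suc m)) (suc m ^ n) (vol n q) (errorConst q * suc m ^ n′) {{m^n≢0 (suc m) n}} ε 0<ε
      (gridCount-upper m q q≤2n′ (n≤m M≤m)) (lower m M≤m) (small m M≤m)
    where
    M : ℕ
    M = n + errorConst q * ℚ.↧ₙ ε
    n≤m : ∀ {m} → M ≤ m → n ≤ suc m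
    n≤m M≤m = ≤-trans (m≤m+n n _) (≤-trans M≤m (n≤1+n _))
    lower : ∀ m → M ≤ m → vol n q * suc m ^ n ≤ n ! * gridCount n (suc q) (suc m) + errorConst q * suc m ^ n′
    lower m M≤m = ≤-trans (gridCount-lower m q q≤2n′ (n≤m M≤m))
      (+-monoʳ-≤ _ (≤-trans (≤-reflexive (sym (*-assoc (vol n q) (n * n) _))) (*-monoˡ-≤ (suc m ^ n′) v*n*n≤E)))
      where
      v*n*n≤E : vol n q * (n * n) ≤ errorConst q
      v*n*n≤E = ≤-trans (*-monoʳ-≤ (vol n q) (m≤m*n (n * n) (2 ^ n′) {{m^n≢0 2 n′}})) (m≤m+n _ _)
    small : ∀ m → M ≤ m → errorConst q * suc m ^ n′ * ℚ.↧ₙ ε < suc m ^ n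
    small m M≤m = begin-strict
      errorConst q * suc m ^ n′ * ℚ.↧ₙ ε   ≡⟨ lemma (errorConst q) (suc m ^ n′) (ℚ.↧ₙ ε) ⟩
      errorConst q * ℚ.↧ₙ ε * suc m ^ n′   <⟨ *-monoˡ-< (suc m ^ n′) {{m^n≢0 (suc m) n′}} (s≤s (≤-trans (m≤n+m _ n) M≤m)) ⟩
      suc m * suc m ^ n′                  ∎
      where
      open ≤-Reasoning
      lemma : ∀ a b c → a * b * c ≡ a * c * b
      lemma = solve-∀

  vol-vanishes : ∀ q → 2 * n′ < q → vol n q ≡ 0
  vol-vanishes q 2n′<q = n≤0⇒n≡0 (begin
    vol n q                                         ≡⟨ ∑𝔅-profile n (volumeWeight q) ⟨
    ∑distinct n n (volumeWeight q ∘ profile)        ≤⟨ ∑distinct≤∑ n n _ ⟩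
    ∑ (volumeWeight q ∘ profile) (signedWords n n)  ≡⟨ halfOpenCount≡∑volumeWeight n′ q ⟨
    halfOpenCount n q                               ≡⟨ trans (∑<-cong n (λ a a<n → halfOpenChains-below n (q * n) (suc q * n) n′ a (end-below a a<n))) (∑<-zero n) ⟩
    0                                               ∎)
    where
    open ≤-Reasoning
    end-below : ∀ a → a < n → suc (a + n′ * (2 * n)) ≤ q * n + n′
    end-below a a<n = begin
      suc (a + n′ * (2 * n))   ≤⟨ +-monoˡ-≤ (n′ * (2 * n)) a<n ⟩
      n + n′ * (2 * n)         ≡⟨ lemma n n′ ⟩
      suc (2 * n′) * n         ≤⟨ *-monoˡ-≤ n 2n′<q ⟩
      q * n                    ≤⟨ m≤m+n (q * n) n′ ⟩
      q * n + n′               ∎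
      where
      lemma : ∀ n n′ → n + n′ * (2 * n) ≡ suc (2 * n′) * n
      lemma = solve-∀

  2n∸1≡1+2n′ : 2 * n ∸ 1 ≡ suc (2 * n′)
  2n∸1≡1+2n′ = cong (_∸ 1) (lemma n′)
    where
    lemma : ∀ n′ → 2 * suc n′ ≡ suc (suc (2 * n′))
    lemma = solve-∀

  private
    VolΔ-if : ℕ → Bool → Set
    VolΔ-if q b = if b then HasNormVol n (suc q) (ℕ→ℚ (vol n q)) else ℕ→ℚ (vol n q) ≡ 0ℚ

  vol-VolΔ : ∀ q → VolΔ n (suc q) (ℕ→ℚ (vol n q))
  vol-VolΔ q = byCase (q ≤? 2 * n′)
    where
    byCase : Dec (q ≤ 2 * n′) → VolΔ n (suc q) (ℕ→ℚ (vol n q))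
    byCase (yes q≤2n′) = subst (VolΔ-if q) (sym (≤ᵇ-true (≤-trans (s≤s q≤2n′) (≤-reflexive (sym 2n∸1≡1+2n′)))))
                               (vol-HasNormVol q q≤2n′)
    byCase (no q≰2n′)  = subst (VolΔ-if q) (sym (≤ᵇ-false (≤-trans (≤-reflexive (cong suc 2n∸1≡1+2n′)) (s≤s (≰⇒> q≰2n′)))))
                               (trans (cong ℕ→ℚ (vol-vanishes q (≰⇒> q≰2n′))) (ℚP.0/n≡0 1))

<-by-sandwich : ∀ b X Y K N → X < Y → b * Y ≤ K → K ≤ b * X + N → b ≤ N
<-by-sandwich b X Y K N X<Y bY≤K K≤bX+N = +-cancelˡ-≤ (b * X) b N (begin
  b * X + b    ≡⟨ +-comm (b * X) b ⟩
  b + b * X    ≡⟨ *-suc b X ⟨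
  b * suc X    ≤⟨ *-monoʳ-≤ b X<Y ⟩
  b * Y        ≤⟨ bY≤K ⟩
  K            ≤⟨ K≤bX+N ⟩
  b * X + N    ∎)
  where open ≤-Reasoning

≡-by-sandwich : ∀ b X Y K N → b * X ≤ K → K ≤ b * X + N → b * Y ≤ K → K ≤ b * Y + N → N < b → X ≡ Y
≡-by-sandwich b X Y K N bX≤K K≤bX+N bY≤K K≤bY+N N<b with <-cmp X Y
... | tri< X<Y _ _ = ⊥-elim (<⇒≱ N<b (<-by-sandwich b X Y K N X<Y bY≤K K≤bX+N))
... | tri≈ _ X≡Y _ = X≡Y
... | tri> _ _ Y<X = ⊥-elim (<⇒≱ N<b (<-by-sandwich b Y X K N Y<X bX≤K K≤bY+N))

module Identity (n′ : ℕ) where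
  open Volumes n′

  nonDistinct<binomial : ∃ λ m → 4 * nonDistinctCount (suc m) n < binomial (suc m) n
  nonDistinct<binomial = 2 * n + C , *-cancelˡ-< (n !) _ _ (begin-strict
    n ! * (4 * nonDistinctCount M n)           ≤⟨ *-monoʳ-≤ (n !) (*-monoʳ-≤ 4 (nonDistinctCount≤ M n′)) ⟩
    n ! * (4 * (n * n * (2 * M) ^ n′))         ≡⟨ cong (λ x → n ! * (4 * (n * n * x))) (^-distribʳ-* 2 M n′) ⟩
    n ! * (4 * (n * n * (2 ^ n′ * M ^ n′)))    ≡⟨ lemma (n !) n (2 ^ n′) (M ^ n′) ⟩
    D * M ^ n′                                 <⟨ D*M^n′<[M∸n]^n ⟩
    (M ∸ n) ^ n                                ≤⟨ ∸^≤fallingFactorial M n ⟩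
    fallingFactorial M n                       ≡⟨ !*binomial≡fallingFactorial n M ⟨
    n ! * binomial M n                         ∎)
    where
    open ≤-Reasoning
    D C M : ℕ
    D = 4 * (n ! * (n * n * 2 ^ n′))
    C = 2 ^ n * D
    M = suc (2 * n + C)
    lemma : ∀ F n t X → F * (4 * (n * n * (t * X))) ≡ 4 * (F * (n * n * t)) * X
    lemma = solve-∀
    M≤2[M∸n] : M ≤ 2 * (M ∸ n)
    M≤2[M∸n] = begin
      M                      ≡⟨ m∸n+n≡m n≤M ⟨
      (M ∸ n) + n            ≤⟨ +-monoʳ-≤ (M ∸ n) n≤M∸n ⟩
      (M ∸ n) + (M ∸ n)      ≡⟨ cong (_+_ ((M ∸ n))) (+-identityʳ (M ∸ n)) ⟨
      2 * (M ∸ n)            ∎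
      where
      2n≤M : 2 * n ≤ M
      2n≤M = ≤-trans (m≤m+n (2 * n) C) (n≤1+n _)
      n≤M : n ≤ M
      n≤M = ≤-trans (m≤m+n n (n + 0)) 2n≤M
      n≤M∸n : n ≤ M ∸ n
      n≤M∸n = ≤-trans (≤-reflexive (sym (trans (m+n∸m≡n n (n + 0)) (+-identityʳ n)))) (∸-monoˡ-≤ n 2n≤M)
    D*M^n′<[M∸n]^n : D * M ^ n′ < (M ∸ n) ^ n
    D*M^n′<[M∸n]^n = *-cancelˡ-< (2 ^ n) _ _ (begin-strict
      2 ^ n * (D * M ^ n′)    ≡⟨ *-assoc (2 ^ n) D (M ^ n′) ⟨
      C * M ^ n′              <⟨ *-monoˡ-< (M ^ n′) {{m^n≢0 M n′}} (s≤s (m≤n+m C (2 * n))) ⟩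
      M * M ^ n′              ≤⟨ ^-monoˡ-≤ n M≤2[M∸n] ⟩
      (2 * (M ∸ n)) ^ n       ≡⟨ ^-distribʳ-* 2 (M ∸ n) n ⟩
      2 ^ n * (M ∸ n) ^ n     ∎)

  -- Moving the start of a chain from [m, 2m) or [2m, 3m) down to [0, m) moves the end window [2km, (2k+2)m) onto the
  -- slabs of Δ_{2k}, Δ_{2k+1}, respectively Δ_{2k−1}, Δ_{2k}.
  module _ (k′ m₀ : ℕ) where

    private
      k m q₀ q₁ q₂ lo hi : ℕ
      k  = suc k′
      m  = suc m₀
      q₀ = 2 * k′
      q₁ = suc q₀
      q₂ = suc q₁
      lo = 2 * k * m
      hi = (2 * k + 2) * m

      W : ℕ → ℕ → ℕ
      W q = halfOpenChains m (q * m) (suc q * m) n′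

    middleCount : ℕ
    middleCount = ∑< (2 * m) (λ a → halfOpenChains m lo hi n′ (m + a))

    middleCount≡∑desBSlabs : middleCount ≡ ∑ (desBSlabs k ∘ profile) (signedWords m n)
    middleCount≡∑desBSlabs = trans (ChainEncoding.halfOpenChains-fromMiddle m lo hi n′)
                                   (∑-signedWords-congᴮ m n (middleStartChains-desBSlabs m₀ k))

    ∑distinct-desBSlabs : ∑distinct m n (desBSlabs k ∘ profile) ≡ binomial m n * B n k
    ∑distinct-desBSlabs = trans (∑distinct-profile n (desBSlabs k) m)
      (cong (binomial m n *_) (trans (∑𝔅-cong n (desBSlabs≡hasDesB k)) (sym (B≡∑𝔅-hasDesB n k))))

    middleCount-lower-B : binomial m n * B n k ≤ middleCount
    middleCount-lower-B = begin
      binomial m n * B n k                          ≡⟨ ∑distinct-desBSlabs ⟨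
      ∑distinct m n (desBSlabs k ∘ profile)         ≤⟨ ∑distinct≤∑ m n _ ⟩
      ∑ (desBSlabs k ∘ profile) (signedWords m n)   ≡⟨ middleCount≡∑desBSlabs ⟨
      middleCount                                   ∎
      where open ≤-Reasoning

    middleCount-upper-B : middleCount ≤ binomial m n * B n k + 4 * nonDistinctCount m n
    middleCount-upper-B = begin
      middleCount                                                      ≡⟨ middleCount≡∑desBSlabs ⟩
      ∑ (desBSlabs k ∘ profile) (signedWords m n)                      ≤⟨ ∑≤∑distinct+nonDistinct m n _ (λ w → 𝟙≤1 _) ⟩
      ∑distinct m n (desBSlabs k ∘ profile) + nonDistinctCount m n     ≡⟨ cong (_+ nonDistinctCount m n) ∑distinct-desBSlabs ⟩
      binomial m n * B n k + nonDistinctCount m n                      ≤⟨ +-monoʳ-≤ _ (m≤n*m (nonDistinctCount m n) 4) ⟩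
      binomial m n * B n k + 4 * nonDistinctCount m n                  ∎
      where open ≤-Reasoning

    fromLowerThird : ∀ a → halfOpenChains m lo hi n′ (m + a) ≡ W q₁ a + W q₂ a
    fromLowerThird a = begin
      halfOpenChains m lo hi n′ (m + a)                               ≡⟨ cong₂ (λ x y → halfOpenChains m x y n′ (m + a)) (lemma k′ m) (lemma′ k′ m) ⟩
      halfOpenChains m (q₁ * m + m) (suc q₂ * m + m) n′ (m + a)       ≡⟨ cong (halfOpenChains m (q₁ * m + m) (suc q₂ * m + m) n′) (+-comm m a) ⟩
      halfOpenChains m (q₁ * m + m) (suc q₂ * m + m) n′ (a + m)       ≡⟨ halfOpenChains-shift m (q₁ * m) (suc q₂ * m) n′ a m ⟩
      halfOpenChains m (q₁ * m) (suc q₂ * m) n′ a                     ≡⟨ halfOpenChains-split m (q₁ * m) (q₂ * m) (suc q₂ * m) n′ a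
                                                                           (*-monoˡ-≤ m (n≤1+n q₁)) (*-monoˡ-≤ m (n≤1+n q₂)) ⟩
      W q₁ a + W q₂ a                                                 ∎
      where
      open ≡-Reasoning
      lemma : ∀ k′ m → 2 * suc k′ * m ≡ suc (2 * k′) * m + m
      lemma = solve-∀
      lemma′ : ∀ k′ m → (2 * suc k′ + 2) * m ≡ suc (suc (suc (2 * k′))) * m + m
      lemma′ = solve-∀

    fromUpperThird : ∀ a → halfOpenChains m lo hi n′ (m + (m + a)) ≡ W q₀ a + W q₁ a
    fromUpperThird a = begin
      halfOpenChains m lo hi n′ (m + (m + a))                                  ≡⟨ cong₃ (lemma k′ m) (lemma′ k′ m) (lemma″ m a) ⟩
      halfOpenChains m (q₀ * m + (m + m)) (suc q₁ * m + (m + m)) n′ (a + (m + m)) ≡⟨ halfOpenChains-shift m (q₀ * m) (suc q₁ * m) n′ a (m + m) ⟩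
      halfOpenChains m (q₀ * m) (suc q₁ * m) n′ a                              ≡⟨ halfOpenChains-split m (q₀ * m) (q₁ * m) (suc q₁ * m) n′ a
                                                                                    (*-monoˡ-≤ m (n≤1+n q₀)) (*-monoˡ-≤ m (n≤1+n q₁)) ⟩
      W q₀ a + W q₁ a                                                          ∎
      where
      open ≡-Reasoning
      cong₃ : ∀ {x x′ y y′ z z′} → x ≡ x′ → y ≡ y′ → z ≡ z′ → halfOpenChains m x y n′ z ≡ halfOpenChains m x′ y′ n′ z′
      cong₃ refl refl refl = refl
      lemma : ∀ k′ m → 2 * suc k′ * m ≡ 2 * k′ * m + (m + m)
      lemma = solve-∀
      lemma′ : ∀ k′ m → (2 * suc k′ + 2) * m ≡ suc (suc (2 * k′)) * m + (m + m)
      lemma′ = solve-∀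
      lemma″ : ∀ m a → m + (m + a) ≡ a + (m + m)
      lemma″ = solve-∀

    middleCount≡slabs : middleCount ≡ (halfOpenCount m q₁ + halfOpenCount m q₂) + (halfOpenCount m q₀ + halfOpenCount m q₁)
    middleCount≡slabs = trans (∑<-double m (λ a → halfOpenChains m lo hi n′ (m + a)))
      (cong₂ _+_ (trans (∑<-cong m (λ a _ → fromLowerThird a)) (∑<-+ m (W q₁) (W q₂)))
                 (trans (∑<-cong m (λ a _ → fromUpperThird a)) (∑<-+ m (W q₀) (W q₁))))

    volSum : ℕ
    volSum = (vol n q₁ + vol n q₂) + (vol n q₀ + vol n q₁)

    middleCount-lower-vol : binomial m n * volSum ≤ middleCount
    middleCount-lower-vol = begin
      binomial m n * volSum                                                    ≡⟨ lemma (binomial m n) (vol n q₁) (vol n q₂) (vol n q₀) ⟩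
      (b * vol n q₁ + b * vol n q₂) + (b * vol n q₀ + b * vol n q₁)            ≤⟨ +-mono-≤ (+-mono-≤ (halfOpenCount-lower m₀ q₁) (halfOpenCount-lower m₀ q₂))
                                                                                            (+-mono-≤ (halfOpenCount-lower m₀ q₀) (halfOpenCount-lower m₀ q₁)) ⟩
      (halfOpenCount m q₁ + halfOpenCount m q₂) + (halfOpenCount m q₀ + halfOpenCount m q₁) ≡⟨ middleCount≡slabs ⟨
      middleCount                                                              ∎
      where
      open ≤-Reasoning
      b = binomial m n
      lemma : ∀ b x y z → b * ((x + y) + (z + x)) ≡ (b * x + b * y) + (b * z + b * x)
      lemma = solve-∀

    middleCount-upper-vol : middleCount ≤ binomial m n * volSum + 4 * nonDistinctCount m n
    middleCount-upper-vol = begin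
      middleCount                                                              ≡⟨ middleCount≡slabs ⟩
      (halfOpenCount m q₁ + halfOpenCount m q₂) + (halfOpenCount m q₀ + halfOpenCount m q₁)
                                                                               ≤⟨ +-mono-≤ (+-mono-≤ (halfOpenCount-upper m₀ q₁) (halfOpenCount-upper m₀ q₂))
                                                                                           (+-mono-≤ (halfOpenCount-upper m₀ q₀) (halfOpenCount-upper m₀ q₁)) ⟩
      (b * vol n q₁ + N + (b * vol n q₂ + N)) + (b * vol n q₀ + N + (b * vol n q₁ + N))
                                                                               ≡⟨ lemma b (vol n q₁) (vol n q₂) (vol n q₀) N ⟩
      binomial m n * volSum + 4 * nonDistinctCount m n                         ∎
      where
      open ≤-Reasoning
      b = binomial m n
      N = nonDistinctCount m n
      lemma : ∀ b x y z N → (b * x + N + (b * y + N)) + (b * z + N + (b * x + N)) ≡ b * ((x + y) + (z + x)) + 4 * N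
      lemma = solve-∀

  B≡vol+2vol+vol : ∀ k′ → B n (suc k′) ≡ vol n (2 * k′) + 2 * vol n (suc (2 * k′)) + vol n (suc (suc (2 * k′)))
  B≡vol+2vol+vol k′ = atScale nonDistinct<binomial
    where
    lemma : ∀ a b c → (b + c) + (a + b) ≡ a + 2 * b + c
    lemma = solve-∀
    atScale : ∃ (λ m → 4 * nonDistinctCount (suc m) n < binomial (suc m) n) →
              B n (suc k′) ≡ vol n (2 * k′) + 2 * vol n (suc (2 * k′)) + vol n (suc (suc (2 * k′)))
    atScale (m₀ , 4N<b) = trans
      (≡-by-sandwich (binomial (suc m₀) n) (B n (suc k′)) (volSum k′ m₀) (middleCount k′ m₀) (4 * nonDistinctCount (suc m₀) n)
                     (middleCount-lower-B k′ m₀) (middleCount-upper-B k′ m₀) (middleCount-lower-vol k′ m₀) (middleCount-upper-vol k′ m₀) 4N<b)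
      (lemma (vol n (2 * k′)) (vol n (suc (2 * k′))) (vol n (suc (suc (2 * k′)))))

corollaryD : (n k : ℕ) → 1 ≤ n → 1 ≤ k →
    ∃ λ (V₁ : ℚ) → ∃ λ (V₂ : ℚ) → ∃ λ (V₃ : ℚ) →
      VolΔ n (2 * k ∸ 1) V₁ × VolΔ n (2 * k) V₂ × VolΔ n (2 * k + 1) V₃ ×
      ((+ B n k) ℚ./ 1 ≡ (V₁ ℚ.+ ((+ 2) ℚ./ 1) ℚ.* V₂) ℚ.+ V₃)
corollaryD (suc n′) k@(suc k′) _ _ =
  ℕ→ℚ v₀ , ℕ→ℚ v₁ , ℕ→ℚ v₂ ,
  subst (λ j → VolΔ n j (ℕ→ℚ v₀)) (cong (_∸ 1) (sym 2k≡)) (vol-VolΔ q₀) ,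
  subst (λ j → VolΔ n j (ℕ→ℚ v₁)) (sym 2k≡) (vol-VolΔ q₁) ,
  subst (λ j → VolΔ n j (ℕ→ℚ v₂)) (sym (trans (cong (_+ 1) 2k≡) (+-comm q₂ 1))) (vol-VolΔ q₂) ,
  (begin
    ℕ→ℚ (B n k)                                 ≡⟨ cong ℕ→ℚ (B≡vol+2vol+vol k′) ⟩
    ℕ→ℚ (v₀ + 2 * v₁ + v₂)                      ≡⟨ ℕ→ℚ-+ (v₀ + 2 * v₁) v₂ ⟩
    ℕ→ℚ (v₀ + 2 * v₁) ℚ.+ ℕ→ℚ v₂                ≡⟨ cong (ℚ._+ ℕ→ℚ v₂) (ℕ→ℚ-+ v₀ (2 * v₁)) ⟩
    (ℕ→ℚ v₀ ℚ.+ ℕ→ℚ (2 * v₁)) ℚ.+ ℕ→ℚ v₂        ≡⟨ cong (λ x → (ℕ→ℚ v₀ ℚ.+ x) ℚ.+ ℕ→ℚ v₂) (ℕ→ℚ-* 2 v₁) ⟩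
    (ℕ→ℚ v₀ ℚ.+ ℕ→ℚ 2 ℚ.* ℕ→ℚ v₁) ℚ.+ ℕ→ℚ v₂   ∎)
  where
  open Volumes n′
  open Identity n′
  open ≡-Reasoning
  q₀ q₁ q₂ v₀ v₁ v₂ : ℕ
  q₀ = 2 * k′
  q₁ = suc q₀
  q₂ = suc q₁
  v₀ = vol n q₀
  v₁ = vol n q₁
  v₂ = vol n q₂
  2k≡ : 2 * k ≡ suc q₁
  2k≡ = *-suc 2 k′
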